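{- Let $n\ge 2$ and let $k_1,\dots,k_n\ge 3$ be integers. Let $\mathcal{H}_{\{k_1-1,\dots,k_n-1\}}$ be the hinge graph obtained by gluing cycle graphs with $k_1,\dots,k_n$ vertices along one common edge. Put $a:=(k_1-1)\cdots(k_n-1)$. Then $$|K(\mathcal{H}_{\{k_1-1,\dots,k_n-1\}})| = a + \frac{a}{k_1-1} + \cdots + \frac{a}{k_n-1}.$$
   Context: The hinge graph $\mathcal{H}_{\{k_1-1,\dots,k_n-1\}}$ is the simple graph with two distinguished ("shared") vertices $x,y$ joined by an edge $xy$, together with $n$ internally vertex-disjoint paths from $x$ to $y$, the $i$-th path having $k_i-2$ internal vertices (so the $i$-th path together with $xy$ is a cycle with $k_i$ vertices). The critical group $K(G)$ of a finite connected graph $G$ is the group of degree-zero divisors modulo the image of the graph Laplacian (the torsion part of the cokernel of the Laplacian); its order equals the number of spanning trees of $G$. -}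

module Defs where

open import Data.Nat as ℕ using (ℕ; zero; suc; _∸_; _≟_; NonZero)
open import Data.Integer as ℤ using (ℤ; 0ℤ)
open import Data.Fin using (Fin; toℕ)
import Data.Fin as Fin
open import Data.Vec using (Vec; []; _∷_)
open import Data.List using (List; []; _∷_; _++_)
open import Data.Product using (Σ; _×_; _,_; ∃; proj₁)
open import Relation.Nullary using (yes; no; Dec)
open import Relation.Binary.PropositionalEquality using (_≡_)

-- Finite graphs: V vertices labelled 0 … V-1, and a list of (undirected)
-- edges given by pairs of vertex labels.

record Graph : Set where
  field
    V     : ℕ
    edges : List (ℕ × ℕ)
open Graph public

Σℤ : ∀ {V} → (Fin V → ℤ) → ℤ
Σℤ {zero}  f = 0ℤ
Σℤ {suc V} f = f Fin.zero ℤ.+ Σℤ (λ i → f (Fin.suc i))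

-- extend a function on Fin V to labels ℕ (labels ≥ V never occur in edges
-- of the graphs constructed below)
ext : ∀ {V} → (Fin V → ℤ) → ℕ → ℤ
ext {zero}  z n       = 0ℤ
ext {suc V} z zero    = z Fin.zero
ext {suc V} z (suc n) = ext (λ i → z (Fin.suc i)) n

ifEq : ∀ {P : Set} → Dec P → ℤ → ℤ
ifEq (yes _) t = t
ifEq (no _)  _ = 0ℤ

edgeTerm : ∀ {V} → (Fin V → ℤ) → Fin V → ℕ × ℕ → ℤ
edgeTerm z v (a , b) =
  ifEq (toℕ v ≟ a) (ext z a ℤ.- ext z b) ℤ.+ ifEq (toℕ v ≟ b) (ext z b ℤ.- ext z a)

-- Graph Laplacian:  (L z)(v) = Σ_{w ~ v} (z v - z w)  = deg(v) z(v) - Σ_{w ~ v} z(w)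
laplacian : (G : Graph) → (Fin (V G) → ℤ) → Fin (V G) → ℤ
laplacian G z v = go (edges G)
  where
  go : List (ℕ × ℕ) → ℤ
  go []       = 0ℤ
  go (e ∷ es) = edgeTerm z v e ℤ.+ go es

Divisor : Graph → Set
Divisor G = Fin (V G) → ℤ

deg : (G : Graph) → Divisor G → ℤ
deg G d = Σℤ d

Div⁰ : Graph → Set
Div⁰ G = Σ (Divisor G) (λ d → deg G d ≡ 0ℤ)

LinEq : (G : Graph) → Div⁰ G → Div⁰ G → Set
LinEq G d d′ =
  ∃ λ (z : Fin (V G) → ℤ) → ∀ v → proj₁ d v ℤ.- proj₁ d′ v ≡ laplacian G z v

-- The critical group K(G) = Div⁰(G) / im(L) (as a setoid quotient).
-- "|K(G)| = N" : there is a bijection between Fin N and the quotient,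
-- i.e. a map Fin N → Div⁰ G that hits every class exactly once.
CriticalGroupOrder : Graph → ℕ → Set
CriticalGroupOrder G N =
  Σ (Fin N → Div⁰ G) λ f →
    (∀ d → ∃ λ i → LinEq G (f i) d) ×
    (∀ i j → LinEq G (f i) (f j) → i ≡ j)

-- Hinge graph.  Vertex 0 = x, vertex 1 = y, edge xy.  For each k in ks a
-- path x – s – s+1 – … – s+(k-3) – y with k-2 fresh internal vertices.

pathFrom : ℕ → ℕ → List (ℕ × ℕ)
pathFrom v zero    = (v , 1) ∷ []
pathFrom v (suc r) = (v , suc v) ∷ pathFrom (suc v) r

hingeEdges : ∀ {n} → ℕ → Vec ℕ n → List (ℕ × ℕ)
hingeEdges s []       = []
hingeEdges s (k ∷ ks) = ((0 , s) ∷ pathFrom s (k ∸ 3)) ++ hingeEdges (s ℕ.+ (k ∸ 2)) ks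

sumV : ∀ {n} → Vec ℕ n → ℕ
sumV []       = 0
sumV (k ∷ ks) = k ℕ.+ sumV ks

internalCount : ∀ {n} → Vec ℕ n → ℕ
internalCount []       = 0
internalCount (k ∷ ks) = (k ∸ 2) ℕ.+ internalCount ks

hinge : ∀ {n} → Vec ℕ n → Graph
hinge ks = record { V = 2 ℕ.+ internalCount ks ; edges = (0 , 1) ∷ hingeEdges 2 ks }

prodPred : ∀ {n} → Vec ℕ n → ℕ
prodPred []       = 1
prodPred (k ∷ ks) = (k ∸ 1) ℕ.* prodPred ks

-- a / (k - 1); for k ≥ 3 we have k - 1 = suc (k - 2) (nonzero divisor)
divPred : ℕ → ℕ → ℕ
divPred a k = a ℕ./ suc (k ∸ 2)

sumQuot : ∀ {n} → ℕ → Vec ℕ n → ℕ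
sumQuot a []       = 0
sumQuot a (k ∷ ks) = divPred a k ℕ.+ sumQuot a ks

-- Write mᵢ = kᵢ − 1, x = 0 and y = 1.  Reading the Laplacian equations along the
-- i-th path shows that the invariants Ψ(d) = (d(x), W₁(d), …, Wₙ(d)), where Wᵢ(d)
-- weighs each internal vertex v of the i-th path by its distance to y, identify
-- K(H) with (ℤ × ℤⁿ)/Λ for the lattice Λ of points (−T − Σ qᵢ , (−T + mᵢ qᵢ)ᵢ):
-- Ψ maps Laplacians into Λ, every degree-zero divisor with Ψ-value in Λ is a
-- Laplacian (solve for the potential path by path), and Ψ is onto.  Each class of
-- (ℤ × ℤⁿ)/Λ has exactly one representative (e , r) with 0 ≤ rᵢ < mᵢ and
-- 0 ≤ e ≤ #{i | rᵢ = 0}: reduce each cᵢ modulo mᵢ, then use the Λ-point with T = ±1,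
-- which shifts all rᵢ cyclically by one and e by one more than the number of zeros.
-- Hence |K(H)| = Σᵣ (1 + #{i | rᵢ = 0}) = a + Σᵢ a/mᵢ.

module Submission where

open import Defs
open import Data.Nat as ℕ using (ℕ; zero; suc; _∸_; z≤n; s≤s; _≤_; _<_)
import Data.Nat.Properties as ℕₚ
import Data.Nat.DivMod as ℕ
open import Data.Nat.Divisibility using (_∣_; ∣m⇒∣m*n; ∣n⇒∣m*n; ∣-refl)
open import Data.Integer as ℤ using (ℤ; +_; -[1+_]; 0ℤ; _+_; _-_; _*_; -_)
import Data.Integer.Properties as ℤₚ
import Data.Integer.DivMod as ℤ
open import Data.Integer.Tactic.RingSolver using (solve-∀)
open import Data.Fin as Fin using (Fin; toℕ)
import Data.Fin.Properties as Finₚ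
open import Data.Vec using (Vec; []; _∷_; zipWith; map; replicate)
open import Data.Vec.Properties using (∷-injectiveˡ; ∷-injectiveʳ)
open import Data.Vec.Relation.Unary.All using (All; []; _∷_)
open import Data.List using (List; []; _∷_; _++_)
open import Data.Product using (Σ; _×_; _,_; proj₁; proj₂; ∃; uncurry)
open import Data.Sum using (_⊎_; inj₁; inj₂; [_,_]′)
open import Data.Empty using (⊥; ⊥-elim)
open import Data.Unit using (⊤; tt)
open import Relation.Nullary using (yes; no)
open import Relation.Binary.PropositionalEquality

ifEq-yes : ∀ {a b : ℕ} (t : ℤ) → a ≡ b → ifEq (a ℕ.≟ b) t ≡ t
ifEq-yes {a} {b} t a≡b with a ℕ.≟ b
... | yes _   = refl
... | no  a≢b = ⊥-elim (a≢b a≡b)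

ifEq-no : ∀ {a b : ℕ} (t : ℤ) → a ≢ b → ifEq (a ℕ.≟ b) t ≡ 0ℤ
ifEq-no {a} {b} t a≢b with a ℕ.≟ b
... | yes a≡b = ⊥-elim (a≢b a≡b)
... | no  _   = refl

+-vanishˡ : ∀ {a b : ℤ} → a ≡ 0ℤ → a + b ≡ b
+-vanishˡ {b = b} a≡0 = trans (cong (_+ b) a≡0) (ℤₚ.+-identityˡ b)

+-vanishʳ : ∀ {a b : ℤ} → b ≡ 0ℤ → a + b ≡ a
+-vanishʳ {a} b≡0 = trans (cong (_+_ a) b≡0) (ℤₚ.+-identityʳ a)

ext-toℕ : ∀ {V} (f : Fin V → ℤ) v → ext f (toℕ v) ≡ f v
ext-toℕ {suc V} f Fin.zero    = refl
ext-toℕ {suc V} f (Fin.suc v) = ext-toℕ (λ i → f (Fin.suc i)) v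

ext-unique : ∀ {V} (f : Fin V → ℤ) (g : ℕ → ℤ) → (∀ v → f v ≡ g (toℕ v)) → (∀ ℓ → V ≤ ℓ → g ℓ ≡ 0ℤ) →
  ∀ ℓ → ext f ℓ ≡ g ℓ
ext-unique {zero}  f g f≗g g≡0 ℓ       = sym (g≡0 ℓ z≤n)
ext-unique {suc V} f g f≗g g≡0 zero    = f≗g Fin.zero
ext-unique {suc V} f g f≗g g≡0 (suc ℓ) =
  ext-unique (λ i → f (Fin.suc i)) (λ ℓ → g (suc ℓ)) (λ v → f≗g (Fin.suc v)) (λ ℓ V≤ℓ → g≡0 (suc ℓ) (s≤s V≤ℓ)) ℓ

ext-sub : ∀ {V} (f g : Fin V → ℤ) ℓ → ext (λ v → f v - g v) ℓ ≡ ext f ℓ - ext g ℓ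
ext-sub {zero}  f g ℓ       = refl
ext-sub {suc V} f g zero    = refl
ext-sub {suc V} f g (suc ℓ) = ext-sub (λ i → f (Fin.suc i)) (λ i → g (Fin.suc i)) ℓ

ext-cong : ∀ {V} {f g : Fin V → ℤ} → (∀ v → f v ≡ g v) → ∀ ℓ → ext f ℓ ≡ ext g ℓ
ext-cong {zero}  f≗g ℓ       = refl
ext-cong {suc V} f≗g zero    = f≗g Fin.zero
ext-cong {suc V} f≗g (suc ℓ) = ext-cong (λ v → f≗g (Fin.suc v)) ℓ

edgeTermℕ : (ℕ → ℤ) → ℕ → ℕ × ℕ → ℤ
edgeTermℕ z ℓ (a , b) = ifEq (ℓ ℕ.≟ a) (z a - z b) + ifEq (ℓ ℕ.≟ b) (z b - z a)

laplacianℕ : List (ℕ × ℕ) → (ℕ → ℤ) → ℕ → ℤ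
laplacianℕ []       z ℓ = 0ℤ
laplacianℕ (e ∷ es) z ℓ = edgeTermℕ z ℓ e + laplacianℕ es z ℓ

-- `laplacian` recurses through a where-bound helper that cannot be named from
-- outside; the metavariable in `laplacianAlong` is solved by unification to it.
private
  mutual
    laplacianAlong : (G : Graph) → (Fin (V G) → ℤ) → Fin (V G) → List (ℕ × ℕ) → ℤ
    laplacianAlong G z v = _

    laplacian≡laplacianAlong : ∀ G z v → laplacian G z v ≡ laplacianAlong G z v (edges G)
    laplacian≡laplacianAlong G z v with edges G
    ... | es = refl

  laplacianAlong≡laplacianℕ : ∀ G z v es → laplacianAlong G z v es ≡ laplacianℕ es (ext z) (toℕ v)
  laplacianAlong≡laplacianℕ G z v []       = refl
  laplacianAlong≡laplacianℕ G z v (e ∷ es) = cong (_+_ (edgeTerm z v e)) (laplacianAlong≡laplacianℕ G z v es)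

laplacian≡laplacianℕ : ∀ G z v → laplacian G z v ≡ laplacianℕ (edges G) (ext z) (toℕ v)
laplacian≡laplacianℕ G z v =
  trans (laplacian≡laplacianAlong G z v) (laplacianAlong≡laplacianℕ G z v (edges G))

laplacianℕ-cong : ∀ es {z z′ : ℕ → ℤ} → (∀ ℓ → z ℓ ≡ z′ ℓ) → ∀ ℓ → laplacianℕ es z ℓ ≡ laplacianℕ es z′ ℓ
laplacianℕ-cong []             z≗z′ ℓ = refl
laplacianℕ-cong ((a , b) ∷ es) {z′ = z′} z≗z′ ℓ
  rewrite z≗z′ a | z≗z′ b = cong (_+_ (edgeTermℕ z′ ℓ (a , b))) (laplacianℕ-cong es z≗z′ ℓ)

laplacian-labels : ∀ G (z : ℕ → ℤ) → (∀ ℓ → V G ≤ ℓ → z ℓ ≡ 0ℤ) →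
  ∀ v → laplacian G (λ v → z (toℕ v)) v ≡ laplacianℕ (edges G) z (toℕ v)
laplacian-labels G z z≡0 v =
  trans (laplacian≡laplacianℕ G _ v)
        (laplacianℕ-cong (edges G) (ext-unique (λ v → z (toℕ v)) z (λ _ → refl) z≡0) (toℕ v))

laplacianℕ-++ : ∀ es fs z ℓ → laplacianℕ (es ++ fs) z ℓ ≡ laplacianℕ es z ℓ + laplacianℕ fs z ℓ
laplacianℕ-++ []       fs z ℓ = sym (ℤₚ.+-identityˡ _)
laplacianℕ-++ (e ∷ es) fs z ℓ =
  trans (cong (_+_ (edgeTermℕ z ℓ e)) (laplacianℕ-++ es fs z ℓ)) (sym (ℤₚ.+-assoc (edgeTermℕ z ℓ e) _ _))

module _ (z : ℕ → ℤ) {ℓ a b : ℕ} where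

  edgeTermℕ-away : ℓ ≢ a → ℓ ≢ b → edgeTermℕ z ℓ (a , b) ≡ 0ℤ
  edgeTermℕ-away ℓ≢a ℓ≢b = cong₂ _+_ (ifEq-no _ ℓ≢a) (ifEq-no _ ℓ≢b)

  edgeTermℕ-src : ℓ ≡ a → ℓ ≢ b → edgeTermℕ z ℓ (a , b) ≡ z a - z b
  edgeTermℕ-src ℓ≡a ℓ≢b = trans (cong₂ _+_ (ifEq-yes _ ℓ≡a) (ifEq-no _ ℓ≢b)) (ℤₚ.+-identityʳ _)

  edgeTermℕ-tgt : ℓ ≢ a → ℓ ≡ b → edgeTermℕ z ℓ (a , b) ≡ z b - z a
  edgeTermℕ-tgt ℓ≢a ℓ≡b = trans (cong₂ _+_ (ifEq-no _ ℓ≢a) (ifEq-yes _ ℓ≡b)) (ℤₚ.+-identityˡ _)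

pathEnd : ℕ → ℕ → ℕ
pathEnd v zero    = v
pathEnd v (suc r) = pathEnd (suc v) r

≤-pathEnd : ∀ v r → v ≤ pathEnd v r
≤-pathEnd v zero    = ℕₚ.≤-refl
≤-pathEnd v (suc r) = ℕₚ.<⇒≤ (≤-pathEnd (suc v) r)

pathEnd≡+ : ∀ v r → pathEnd v r ≡ v ℕ.+ r
pathEnd≡+ v zero    = sym (ℕₚ.+-identityʳ v)
pathEnd≡+ v (suc r) = trans (pathEnd≡+ (suc v) r) (sym (ℕₚ.+-suc v r))

pathSucc : ℕ → ℕ → ℕ
pathSucc v zero    = 1
pathSucc v (suc r) = suc v

PathLaplacian : (h z : ℕ → ℤ) → ℕ → ℕ → ℤ → ℤ → Set
PathLaplacian h z s zero    a b = h s ≡ (z s - a) + (z s - b)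
PathLaplacian h z s (suc r) a b =
  h s ≡ (z s - a) + (z s - z (suc s)) × PathLaplacian h z (suc s) r (z s) b

InPath : ℕ → ℕ → ℕ → Set
InPath s r ℓ = s ≤ ℓ × ℓ ≤ pathEnd s r

InPath-suc : ∀ s r {ℓ} → InPath (suc s) r ℓ → InPath s (suc r) ℓ
InPath-suc s r (s<ℓ , ℓ≤end) = ℕₚ.<⇒≤ s<ℓ , ℓ≤end

PathLaplacian-cong-lap : ∀ {h h′ z} s r a b → (∀ ℓ → InPath s r ℓ → h ℓ ≡ h′ ℓ) →
  PathLaplacian h z s r a b → PathLaplacian h′ z s r a b
PathLaplacian-cong-lap s zero    a b h≗h′ eq = trans (sym (h≗h′ s (ℕₚ.≤-refl , ℕₚ.≤-refl))) eq
PathLaplacian-cong-lap {z = z} s (suc r) a b h≗h′ (eq , rest) =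
  trans (sym (h≗h′ s (ℕₚ.≤-refl , ≤-pathEnd s (suc r)))) eq ,
  PathLaplacian-cong-lap (suc s) r (z s) b (λ ℓ ℓ∈ → h≗h′ ℓ (InPath-suc s r ℓ∈)) rest

PathLaplacian-cong-pot : ∀ {h z z′} s r a b → (∀ ℓ → InPath s r ℓ → z ℓ ≡ z′ ℓ) →
  PathLaplacian h z s r a b → PathLaplacian h z′ s r a b
PathLaplacian-cong-pot s zero a b z≗z′ eq =
  trans eq (cong (λ x → (x - a) + (x - b)) (z≗z′ s (ℕₚ.≤-refl , ℕₚ.≤-refl)))
PathLaplacian-cong-pot {h} {z} {z′} s (suc r) a b z≗z′ (eq , rest) =
  trans eq (cong₂ (λ x y → (x - a) + (x - y)) zs≡ (z≗z′ (suc s) (ℕₚ.n≤1+n s , ≤-pathEnd (suc s) r))) ,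
  subst (λ w → PathLaplacian h z′ (suc s) r w b) zs≡
    (PathLaplacian-cong-pot (suc s) r (z s) b (λ ℓ ℓ∈ → z≗z′ ℓ (InPath-suc s r ℓ∈)) rest)
  where
  zs≡ : z s ≡ z′ s
  zs≡ = z≗z′ s (ℕₚ.≤-refl , ≤-pathEnd s (suc r))

module _ (z : ℕ → ℤ) where

  laplacianℕ-pathFrom-x : ∀ v r → 1 ≤ v → laplacianℕ (pathFrom v r) z 0 ≡ 0ℤ
  laplacianℕ-pathFrom-x v zero    1≤v = +-vanishˡ (edgeTermℕ-away z (ℕₚ.<⇒≢ 1≤v) λ ())
  laplacianℕ-pathFrom-x v (suc r) 1≤v =
    trans (+-vanishˡ (edgeTermℕ-away z (ℕₚ.<⇒≢ 1≤v) λ ()))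
          (laplacianℕ-pathFrom-x (suc v) r (ℕₚ.m≤n⇒m≤1+n 1≤v))

  laplacianℕ-pathFrom-y : ∀ v r → 2 ≤ v → laplacianℕ (pathFrom v r) z 1 ≡ z 1 - z (pathEnd v r)
  laplacianℕ-pathFrom-y v zero    2≤v = trans (ℤₚ.+-identityʳ _) (edgeTermℕ-tgt z (ℕₚ.<⇒≢ 2≤v) refl)
  laplacianℕ-pathFrom-y v (suc r) 2≤v =
    trans (+-vanishˡ (edgeTermℕ-away z (ℕₚ.<⇒≢ 2≤v) (ℕₚ.<⇒≢ (ℕₚ.m≤n⇒m≤1+n 2≤v))))
          (laplacianℕ-pathFrom-y (suc v) r (ℕₚ.m≤n⇒m≤1+n 2≤v))

  laplacianℕ-pathFrom-outside : ∀ v r ℓ → 2 ≤ ℓ → ℓ < v ⊎ pathEnd v r < ℓ →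
    laplacianℕ (pathFrom v r) z ℓ ≡ 0ℤ
  laplacianℕ-pathFrom-outside v zero ℓ 2≤ℓ (inj₁ ℓ<v) =
    +-vanishˡ (edgeTermℕ-away z (ℕₚ.<⇒≢ ℓ<v) (ℕₚ.>⇒≢ 2≤ℓ))
  laplacianℕ-pathFrom-outside v zero ℓ 2≤ℓ (inj₂ v<ℓ) =
    +-vanishˡ (edgeTermℕ-away z (ℕₚ.>⇒≢ v<ℓ) (ℕₚ.>⇒≢ 2≤ℓ))
  laplacianℕ-pathFrom-outside v (suc r) ℓ 2≤ℓ (inj₁ ℓ<v) =
    trans (+-vanishˡ (edgeTermℕ-away z (ℕₚ.<⇒≢ ℓ<v) (ℕₚ.<⇒≢ (ℕₚ.m≤n⇒m≤1+n ℓ<v))))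
          (laplacianℕ-pathFrom-outside (suc v) r ℓ 2≤ℓ (inj₁ (ℕₚ.m≤n⇒m≤1+n ℓ<v)))
  laplacianℕ-pathFrom-outside v (suc r) ℓ 2≤ℓ (inj₂ end<ℓ) =
    trans (+-vanishˡ (edgeTermℕ-away z (ℕₚ.>⇒≢ (ℕₚ.≤-<-trans (≤-pathEnd v (suc r)) end<ℓ))
                                       (ℕₚ.>⇒≢ (ℕₚ.≤-<-trans (≤-pathEnd (suc v) r) end<ℓ))))
          (laplacianℕ-pathFrom-outside (suc v) r ℓ 2≤ℓ (inj₂ end<ℓ))

  laplacianℕ-pathFrom-start : ∀ v r → 2 ≤ v → laplacianℕ (pathFrom v r) z v ≡ z v - z (pathSucc v r)
  laplacianℕ-pathFrom-start v zero    2≤v = trans (ℤₚ.+-identityʳ _) (edgeTermℕ-src z refl (ℕₚ.>⇒≢ 2≤v))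
  laplacianℕ-pathFrom-start v (suc r) 2≤v =
    trans (+-vanishʳ (laplacianℕ-pathFrom-outside (suc v) r v 2≤v (inj₁ (ℕₚ.n<1+n v))))
          (edgeTermℕ-src z refl (ℕₚ.<⇒≢ (ℕₚ.n<1+n v)))

  laplacianℕ-pathFrom-second : ∀ v r → 2 ≤ v →
    laplacianℕ (pathFrom v (suc r)) z (suc v) ≡ (z (suc v) - z v) + (z (suc v) - z (pathSucc (suc v) r))
  laplacianℕ-pathFrom-second v r 2≤v =
    cong₂ _+_ (edgeTermℕ-tgt z (ℕₚ.>⇒≢ (ℕₚ.n<1+n v)) refl)
              (laplacianℕ-pathFrom-start (suc v) r (ℕₚ.m≤n⇒m≤1+n 2≤v))

  laplacianℕ-pathFrom-tail : ∀ v r → 2 ≤ v →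
    PathLaplacian (laplacianℕ (pathFrom v (suc r)) z) z (suc v) r (z v) (z 1)
  laplacianℕ-pathFrom-tail v zero    2≤v = laplacianℕ-pathFrom-second v zero 2≤v
  laplacianℕ-pathFrom-tail v (suc r) 2≤v =
    laplacianℕ-pathFrom-second v (suc r) 2≤v ,
    PathLaplacian-cong-lap (suc (suc v)) r (z (suc v)) (z 1) first-edge-vanishes
      (laplacianℕ-pathFrom-tail (suc v) r (ℕₚ.m≤n⇒m≤1+n 2≤v))
    where
    first-edge-vanishes : ∀ ℓ → InPath (suc (suc v)) r ℓ →
      laplacianℕ (pathFrom (suc v) (suc r)) z ℓ ≡ laplacianℕ (pathFrom v (suc (suc r))) z ℓ
    first-edge-vanishes ℓ (2+v≤ℓ , _) =
      sym (+-vanishˡ (edgeTermℕ-away z (ℕₚ.>⇒≢ (ℕₚ.<-trans (ℕₚ.n<1+n v) 2+v≤ℓ)) (ℕₚ.>⇒≢ 2+v≤ℓ)))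

spoke : ℕ → ℕ → List (ℕ × ℕ)
spoke s r = (0 , s) ∷ pathFrom s r

nextStart : ℕ → ℕ → ℕ
nextStart s k = s ℕ.+ (k ∸ 2)

k∸2≡ : ∀ {k} → 3 ≤ k → k ∸ 2 ≡ suc (k ∸ 3)
k∸2≡ (s≤s (s≤s (s≤s _))) = refl

k∸1≡ : ∀ {k} → 3 ≤ k → k ∸ 1 ≡ suc (suc (k ∸ 3))
k∸1≡ (s≤s (s≤s (s≤s _))) = refl

module _ {k : ℕ} (3≤k : 3 ≤ k) where

  suc-pathEnd≡nextStart : ∀ s → suc (pathEnd s (k ∸ 3)) ≡ nextStart s k
  suc-pathEnd≡nextStart s = begin
    suc (pathEnd s (k ∸ 3)) ≡⟨ cong suc (pathEnd≡+ s (k ∸ 3)) ⟩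
    suc (s ℕ.+ (k ∸ 3))     ≡⟨ sym (ℕₚ.+-suc s (k ∸ 3)) ⟩
    s ℕ.+ suc (k ∸ 3)       ≡⟨ cong (s ℕ.+_) (sym (k∸2≡ 3≤k)) ⟩
    nextStart s k           ∎
    where open ≡-Reasoning

  pathEnd<nextStart : ∀ s → pathEnd s (k ∸ 3) < nextStart s k
  pathEnd<nextStart s = ℕₚ.≤-reflexive (suc-pathEnd≡nextStart s)

  <nextStart⇒≤pathEnd : ∀ s {ℓ} → ℓ < nextStart s k → ℓ ≤ pathEnd s (k ∸ 3)
  <nextStart⇒≤pathEnd s {ℓ} ℓ<next = ℕₚ.≤-pred (subst (ℓ <_) (sym (suc-pathEnd≡nextStart s)) ℓ<next)

≤nextStart : ∀ s k → s ≤ nextStart s k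
≤nextStart s k = ℕₚ.m≤m+n s (k ∸ 2)

nextStart-+-internalCount : ∀ {n} s k (ks : Vec ℕ n) →
  nextStart s k ℕ.+ internalCount ks ≡ s ℕ.+ internalCount (k ∷ ks)
nextStart-+-internalCount s k ks = ℕₚ.+-assoc s (k ∸ 2) (internalCount ks)

PathLaplacians : ∀ {n} → (h z : ℕ → ℤ) → ℕ → Vec ℕ n → ℤ → ℤ → Set
PathLaplacians h z s []       a b = ⊤
PathLaplacians h z s (k ∷ ks) a b =
  PathLaplacian h z s (k ∸ 3) a b × PathLaplacians h z (nextStart s k) ks a b

PathLaplacians-cong-lap : ∀ {n} {h h′ z} s (ks : Vec ℕ n) a b → (∀ ℓ → s ≤ ℓ → h ℓ ≡ h′ ℓ) →
  PathLaplacians h z s ks a b → PathLaplacians h′ z s ks a b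
PathLaplacians-cong-lap s []       a b h≗h′ tt           = tt
PathLaplacians-cong-lap s (k ∷ ks) a b h≗h′ (path , rest) =
  PathLaplacian-cong-lap s (k ∸ 3) a b (λ ℓ ℓ∈ → h≗h′ ℓ (proj₁ ℓ∈)) path ,
  PathLaplacians-cong-lap (nextStart s k) ks a b (λ ℓ ≤ℓ → h≗h′ ℓ (ℕₚ.≤-trans (≤nextStart s k) ≤ℓ)) rest

spokesAtX : ∀ {n} → (ℕ → ℤ) → ℕ → Vec ℕ n → ℤ
spokesAtX z s []       = 0ℤ
spokesAtX z s (k ∷ ks) = (z 0 - z s) + spokesAtX z (nextStart s k) ks

spokesAtY : ∀ {n} → (ℕ → ℤ) → ℕ → Vec ℕ n → ℤ
spokesAtY z s []       = 0ℤ
spokesAtY z s (k ∷ ks) = (z 1 - z (pathEnd s (k ∸ 3))) + spokesAtY z (nextStart s k) ks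

module _ (z : ℕ → ℤ) where

  laplacianℕ-spoke-x : ∀ s r → 2 ≤ s → laplacianℕ (spoke s r) z 0 ≡ z 0 - z s
  laplacianℕ-spoke-x s r 2≤s =
    trans (+-vanishʳ (laplacianℕ-pathFrom-x z s r 1≤s)) (edgeTermℕ-src z refl (ℕₚ.<⇒≢ 1≤s))
    where 1≤s = ℕₚ.<⇒≤ 2≤s

  laplacianℕ-spoke-y : ∀ s r → 2 ≤ s → laplacianℕ (spoke s r) z 1 ≡ z 1 - z (pathEnd s r)
  laplacianℕ-spoke-y s r 2≤s =
    trans (+-vanishˡ (edgeTermℕ-away z {1} {0} (λ ()) (ℕₚ.<⇒≢ 2≤s))) (laplacianℕ-pathFrom-y z s r 2≤s)

  laplacianℕ-spoke-outside : ∀ s r ℓ → 2 ≤ ℓ → ℓ < s ⊎ pathEnd s r < ℓ →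
    laplacianℕ (spoke s r) z ℓ ≡ 0ℤ
  laplacianℕ-spoke-outside s r ℓ 2≤ℓ out =
    trans (+-vanishˡ (edgeTermℕ-away z (ℕₚ.>⇒≢ (ℕₚ.<⇒≤ 2≤ℓ)) ℓ≢s))
          (laplacianℕ-pathFrom-outside z s r ℓ 2≤ℓ out)
    where
    ℓ≢s : ℓ ≢ s
    ℓ≢s = [ ℕₚ.<⇒≢ , (λ end<ℓ → ℕₚ.>⇒≢ (ℕₚ.≤-<-trans (≤-pathEnd s r) end<ℓ)) ]′ out

  laplacianℕ-spoke-start : ∀ s r → 2 ≤ s →
    laplacianℕ (spoke s r) z s ≡ (z s - z 0) + (z s - z (pathSucc s r))
  laplacianℕ-spoke-start s r 2≤s =
    cong₂ _+_ (edgeTermℕ-tgt z (ℕₚ.>⇒≢ (ℕₚ.<⇒≤ 2≤s)) refl) (laplacianℕ-pathFrom-start z s r 2≤s)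

  laplacianℕ-spoke-path : ∀ s r → 2 ≤ s → PathLaplacian (laplacianℕ (spoke s r) z) z s r (z 0) (z 1)
  laplacianℕ-spoke-path s zero    2≤s = laplacianℕ-spoke-start s zero 2≤s
  laplacianℕ-spoke-path s (suc r) 2≤s =
    laplacianℕ-spoke-start s (suc r) 2≤s ,
    PathLaplacian-cong-lap (suc s) r (z s) (z 1) x-edge-vanishes (laplacianℕ-pathFrom-tail z s r 2≤s)
    where
    x-edge-vanishes : ∀ ℓ → InPath (suc s) r ℓ →
      laplacianℕ (pathFrom s (suc r)) z ℓ ≡ laplacianℕ (spoke s (suc r)) z ℓ
    x-edge-vanishes ℓ (s<ℓ , _) =
      sym (+-vanishˡ (edgeTermℕ-away z (ℕₚ.>⇒≢ (ℕₚ.≤-<-trans z≤n s<ℓ)) (ℕₚ.>⇒≢ s<ℓ)))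

module _ (z : ℕ → ℤ) where

  laplacianℕ-hingeEdges-x : ∀ {n} s (ks : Vec ℕ n) → 2 ≤ s →
    laplacianℕ (hingeEdges s ks) z 0 ≡ spokesAtX z s ks
  laplacianℕ-hingeEdges-x s []       2≤s = refl
  laplacianℕ-hingeEdges-x s (k ∷ ks) 2≤s =
    trans (laplacianℕ-++ (spoke s (k ∸ 3)) _ z 0)
          (cong₂ _+_ (laplacianℕ-spoke-x z s (k ∸ 3) 2≤s)
                     (laplacianℕ-hingeEdges-x (nextStart s k) ks (ℕₚ.≤-trans 2≤s (≤nextStart s k))))

  laplacianℕ-hingeEdges-y : ∀ {n} s (ks : Vec ℕ n) → 2 ≤ s →
    laplacianℕ (hingeEdges s ks) z 1 ≡ spokesAtY z s ks
  laplacianℕ-hingeEdges-y s []       2≤s = refl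
  laplacianℕ-hingeEdges-y s (k ∷ ks) 2≤s =
    trans (laplacianℕ-++ (spoke s (k ∸ 3)) _ z 1)
          (cong₂ _+_ (laplacianℕ-spoke-y z s (k ∸ 3) 2≤s)
                     (laplacianℕ-hingeEdges-y (nextStart s k) ks (ℕₚ.≤-trans 2≤s (≤nextStart s k))))

  laplacianℕ-hingeEdges-outside : ∀ {n} s (ks : Vec ℕ n) → All (3 ≤_) ks → ∀ ℓ → 2 ≤ ℓ →
    ℓ < s ⊎ s ℕ.+ internalCount ks ≤ ℓ → laplacianℕ (hingeEdges s ks) z ℓ ≡ 0ℤ
  laplacianℕ-hingeEdges-outside s []       _ ℓ 2≤ℓ out = refl
  laplacianℕ-hingeEdges-outside s (k ∷ ks) (3≤k ∷ ks≥3) ℓ 2≤ℓ (inj₁ ℓ<s) =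
    trans (laplacianℕ-++ (spoke s (k ∸ 3)) _ z ℓ)
          (cong₂ _+_ (laplacianℕ-spoke-outside z s (k ∸ 3) ℓ 2≤ℓ (inj₁ ℓ<s))
                     (laplacianℕ-hingeEdges-outside (nextStart s k) ks ks≥3 ℓ 2≤ℓ
                       (inj₁ (ℕₚ.<-≤-trans ℓ<s (≤nextStart s k)))))
  laplacianℕ-hingeEdges-outside s (k ∷ ks) (3≤k ∷ ks≥3) ℓ 2≤ℓ (inj₂ end≤ℓ) =
    trans (laplacianℕ-++ (spoke s (k ∸ 3)) _ z ℓ)
          (cong₂ _+_ (laplacianℕ-spoke-outside z s (k ∸ 3) ℓ 2≤ℓ
                       (inj₂ (ℕₚ.<-≤-trans (pathEnd<nextStart 3≤k s)
                               (ℕₚ.≤-trans (ℕₚ.m≤m+n _ (internalCount ks)) end′≤ℓ))))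
                     (laplacianℕ-hingeEdges-outside (nextStart s k) ks ks≥3 ℓ 2≤ℓ (inj₂ end′≤ℓ)))
    where
    end′≤ℓ : nextStart s k ℕ.+ internalCount ks ≤ ℓ
    end′≤ℓ = subst (_≤ ℓ) (sym (nextStart-+-internalCount s k ks)) end≤ℓ

  laplacianℕ-hingeEdges-paths : ∀ {n} s (ks : Vec ℕ n) → All (3 ≤_) ks → 2 ≤ s →
    PathLaplacians (laplacianℕ (hingeEdges s ks) z) z s ks (z 0) (z 1)
  laplacianℕ-hingeEdges-paths s []       _            2≤s = tt
  laplacianℕ-hingeEdges-paths s (k ∷ ks) (3≤k ∷ ks≥3) 2≤s =
    PathLaplacian-cong-lap s (k ∸ 3) (z 0) (z 1) later-spokes-vanish (laplacianℕ-spoke-path z s (k ∸ 3) 2≤s) ,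
    PathLaplacians-cong-lap (nextStart s k) ks (z 0) (z 1) first-spoke-vanishes
      (laplacianℕ-hingeEdges-paths (nextStart s k) ks ks≥3 (ℕₚ.≤-trans 2≤s (≤nextStart s k)))
    where
    later-spokes-vanish : ∀ ℓ → InPath s (k ∸ 3) ℓ →
      laplacianℕ (spoke s (k ∸ 3)) z ℓ ≡ laplacianℕ (hingeEdges s (k ∷ ks)) z ℓ
    later-spokes-vanish ℓ (s≤ℓ , ℓ≤end) =
      sym (trans (laplacianℕ-++ (spoke s (k ∸ 3)) _ z ℓ)
                 (+-vanishʳ (laplacianℕ-hingeEdges-outside (nextStart s k) ks ks≥3 ℓ (ℕₚ.≤-trans 2≤s s≤ℓ)
                              (inj₁ (ℕₚ.≤-<-trans ℓ≤end (pathEnd<nextStart 3≤k s))))))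
    first-spoke-vanishes : ∀ ℓ → nextStart s k ≤ ℓ →
      laplacianℕ (hingeEdges (nextStart s k) ks) z ℓ ≡ laplacianℕ (hingeEdges s (k ∷ ks)) z ℓ
    first-spoke-vanishes ℓ next≤ℓ =
      sym (trans (laplacianℕ-++ (spoke s (k ∸ 3)) _ z ℓ)
                 (+-vanishˡ (laplacianℕ-spoke-outside z s (k ∸ 3) ℓ
                              (ℕₚ.≤-trans 2≤s (ℕₚ.≤-trans (≤nextStart s k) next≤ℓ))
                              (inj₂ (ℕₚ.<-≤-trans (pathEnd<nextStart 3≤k s) next≤ℓ)))))

  xy-edge-vanishes : ∀ ℓ → 2 ≤ ℓ → edgeTermℕ z ℓ (0 , 1) ≡ 0ℤ
  xy-edge-vanishes ℓ 2≤ℓ = edgeTermℕ-away z (ℕₚ.>⇒≢ (ℕₚ.<⇒≤ 2≤ℓ)) (ℕₚ.>⇒≢ 2≤ℓ)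

  laplacianℕ-hinge-x : ∀ {n} (ks : Vec ℕ n) →
    laplacianℕ (edges (hinge ks)) z 0 ≡ (z 0 - z 1) + spokesAtX z 2 ks
  laplacianℕ-hinge-x ks =
    cong₂ _+_ (edgeTermℕ-src z refl (λ ())) (laplacianℕ-hingeEdges-x 2 ks ℕₚ.≤-refl)

  laplacianℕ-hinge-y : ∀ {n} (ks : Vec ℕ n) →
    laplacianℕ (edges (hinge ks)) z 1 ≡ (z 1 - z 0) + spokesAtY z 2 ks
  laplacianℕ-hinge-y ks =
    cong₂ _+_ (edgeTermℕ-tgt z (λ ()) refl) (laplacianℕ-hingeEdges-y 2 ks ℕₚ.≤-refl)

  laplacianℕ-hinge-outside : ∀ {n} (ks : Vec ℕ n) → All (3 ≤_) ks → ∀ ℓ → V (hinge ks) ≤ ℓ →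
    laplacianℕ (edges (hinge ks)) z ℓ ≡ 0ℤ
  laplacianℕ-hinge-outside ks ks≥3 ℓ V≤ℓ =
    trans (+-vanishˡ (xy-edge-vanishes ℓ 2≤ℓ))
          (laplacianℕ-hingeEdges-outside 2 ks ks≥3 ℓ 2≤ℓ (inj₂ V≤ℓ))
    where 2≤ℓ = ℕₚ.≤-trans (ℕₚ.m≤m+n 2 _) V≤ℓ

  laplacianℕ-hinge-paths : ∀ {n} (ks : Vec ℕ n) → All (3 ≤_) ks →
    PathLaplacians (laplacianℕ (edges (hinge ks)) z) z 2 ks (z 0) (z 1)
  laplacianℕ-hinge-paths ks ks≥3 =
    PathLaplacians-cong-lap 2 ks (z 0) (z 1) (λ ℓ 2≤ℓ → sym (+-vanishˡ (xy-edge-vanishes ℓ 2≤ℓ)))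
      (laplacianℕ-hingeEdges-paths 2 ks ks≥3 ℕₚ.≤-refl)

-- The invariants Ψ and the lattice Λ

sumℤ : ∀ {n} → Vec ℤ n → ℤ
sumℤ []       = 0ℤ
sumℤ (q ∷ qs) = q + sumℤ qs

-- Σ d(v)·dist(v, y) over the vertices v = s, …, pathEnd s r of a path ending at y
moment : (ℕ → ℤ) → ℕ → ℕ → ℤ
moment d s zero    = d s
moment d s (suc r) = + (suc (suc r)) * d s + moment d (suc s) r

moments : ∀ {n} → (ℕ → ℤ) → ℕ → Vec ℕ n → Vec ℤ n
moments d s []       = []
moments d s (k ∷ ks) = moment d s (k ∸ 3) ∷ moments d (nextStart s k) ks

Ψ : ∀ {n} → Vec ℕ n → (ℕ → ℤ) → ℤ × Vec ℤ n
Ψ ks d = d 0 , moments d 2 ks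

-- Ψ of the Laplacian of z has these coordinates with T = z(y) − z(x) and
-- qᵢ = z(sᵢ) − z(x), where sᵢ is the first internal vertex of the i-th path.
ΛCoords : ∀ {n} → ℤ → Vec ℕ n → Vec ℤ n → Vec ℤ n → Set
ΛCoords T []       []       []       = ⊤
ΛCoords T (k ∷ ks) (c ∷ cs) (q ∷ qs) = (c ≡ - T + + (k ∸ 1) * q) × ΛCoords T ks cs qs

_∈Λ_ : ∀ {n} → ℤ × Vec ℤ n → Vec ℕ n → Set
_∈Λ_ {n} (e , cs) ks = Σ ℤ λ T → Σ (Vec ℤ n) λ qs → ΛCoords T ks cs qs × (e ≡ - T - sumℤ qs)

moment-PathLaplacian : ∀ {h z} s r a b → PathLaplacian h z s r a b →
  moment h s r ≡ + (suc (suc r)) * (z s - a) - (b - a)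
moment-PathLaplacian {h} {z} s zero a b eq = trans eq (single (z s) a b)
  where
  single : ∀ x a b → (x - a) + (x - b) ≡ (+ 1 + + 1) * (x - a) - (b - a)
  single = solve-∀
moment-PathLaplacian {h} {z} s (suc r) a b (eq , rest) =
  trans (cong₂ (λ u w → + (suc (suc r)) * u + w) eq (moment-PathLaplacian (suc s) r (z s) b rest))
        (step (+ (suc (suc r))) (z s) a (z (suc s)) b)
  where
  step : ∀ m x a y b → m * ((x - a) + (x - y)) + (m * (y - x) - (b - x)) ≡ (+ 1 + m) * (x - a) - (b - a)
  step = solve-∀

startOffsets : ∀ {n} → (ℕ → ℤ) → ℕ → Vec ℕ n → ℤ → Vec ℤ n
startOffsets z s []       a = []
startOffsets z s (k ∷ ks) a = (z s - a) ∷ startOffsets z (nextStart s k) ks a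

moments-PathLaplacians : ∀ {n} {h z} s (ks : Vec ℕ n) a b → All (3 ≤_) ks →
  PathLaplacians h z s ks a b → ΛCoords (b - a) ks (moments h s ks) (startOffsets z s ks a)
moments-PathLaplacians s []       a b _            tt            = tt
moments-PathLaplacians {h = h} {z} s (k ∷ ks) a b (3≤k ∷ ks≥3) (path , paths) =
  trans (moment-PathLaplacian s (k ∸ 3) a b path)
        (trans (swap (+ suc (suc (k ∸ 3))) (z s - a) (b - a))
               (cong (λ m → - (b - a) + + m * (z s - a)) (sym (k∸1≡ 3≤k)))) ,
  moments-PathLaplacians (nextStart s k) ks a b ks≥3 paths
  where
  swap : ∀ m x t → m * x - t ≡ - t + m * x
  swap = solve-∀

spokesAtX≡-sumℤ : ∀ {n} z s (ks : Vec ℕ n) → spokesAtX z s ks ≡ - sumℤ (startOffsets z s ks (z 0))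
spokesAtX≡-sumℤ z s []       = refl
spokesAtX≡-sumℤ z s (k ∷ ks) =
  trans (cong (_+_ (z 0 - z s)) (spokesAtX≡-sumℤ z (nextStart s k) ks)) (negate (z 0) (z s) _)
  where
  negate : ∀ x y t → (x - y) + - t ≡ - ((y - x) + t)
  negate = solve-∀

Ψ-laplacianℕ∈Λ : ∀ {n} (ks : Vec ℕ n) → All (3 ≤_) ks → (z : ℕ → ℤ) →
  Ψ ks (laplacianℕ (edges (hinge ks)) z) ∈Λ ks
Ψ-laplacianℕ∈Λ ks ks≥3 z =
  z 1 - z 0 , startOffsets z 2 ks (z 0) ,
  moments-PathLaplacians 2 ks (z 0) (z 1) ks≥3 (laplacianℕ-hinge-paths z ks ks≥3) ,
  trans (laplacianℕ-hinge-x z ks)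
        (trans (cong (_+_ (z 0 - z 1)) (spokesAtX≡-sumℤ z 2 ks)) (regroup (z 0) (z 1) _))
  where
  regroup : ∀ x y t → (x - y) + - t ≡ - (y - x) - t
  regroup = solve-∀

sumFrom : (ℕ → ℤ) → ℕ → ℕ → ℤ
sumFrom g s zero    = 0ℤ
sumFrom g s (suc n) = g s + sumFrom g (suc s) n

sumFrom-+ : ∀ g s m n → sumFrom g s (m ℕ.+ n) ≡ sumFrom g s m + sumFrom g (s ℕ.+ m) n
sumFrom-+ g s zero    n =
  sym (trans (ℤₚ.+-identityˡ _) (cong (λ t → sumFrom g t n) (ℕₚ.+-identityʳ s)))
sumFrom-+ g s (suc m) n = begin
  g s + sumFrom g (suc s) (m ℕ.+ n)
    ≡⟨ cong (_+_ (g s)) (sumFrom-+ g (suc s) m n) ⟩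
  g s + (sumFrom g (suc s) m + sumFrom g (suc s ℕ.+ m) n)
    ≡⟨ sym (ℤₚ.+-assoc (g s) _ _) ⟩
  g s + sumFrom g (suc s) m + sumFrom g (suc s ℕ.+ m) n
    ≡⟨ cong (λ t → g s + sumFrom g (suc s) m + sumFrom g t n) (sym (ℕₚ.+-suc s m)) ⟩
  g s + sumFrom g (suc s) m + sumFrom g (s ℕ.+ suc m) n ∎
  where open ≡-Reasoning

sumFrom-cong : ∀ {g g′} s n → (∀ ℓ → g ℓ ≡ g′ ℓ) → sumFrom g s n ≡ sumFrom g′ s n
sumFrom-cong s zero    g≗g′ = refl
sumFrom-cong s (suc n) g≗g′ = cong₂ _+_ (g≗g′ s) (sumFrom-cong (suc s) n g≗g′)

sumFrom-shift : ∀ g s n → sumFrom (λ ℓ → g (suc ℓ)) s n ≡ sumFrom g (suc s) n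
sumFrom-shift g s zero    = refl
sumFrom-shift g s (suc n) = cong (_+_ (g (suc s))) (sumFrom-shift g (suc s) n)

spokeSums : ∀ {n} → (ℕ → ℤ) → ℕ → Vec ℕ n → ℤ
spokeSums g s []       = 0ℤ
spokeSums g s (k ∷ ks) = sumFrom g s (k ∸ 2) + spokeSums g (nextStart s k) ks

sumFrom-internalCount : ∀ {n} g s (ks : Vec ℕ n) → sumFrom g s (internalCount ks) ≡ spokeSums g s ks
sumFrom-internalCount g s []       = refl
sumFrom-internalCount g s (k ∷ ks) =
  trans (sumFrom-+ g s (k ∸ 2) (internalCount ks))
        (cong (_+_ (sumFrom g s (k ∸ 2))) (sumFrom-internalCount g (nextStart s k) ks))

-- the Laplacian of a path telescopes
sumFrom-PathLaplacian : ∀ {h z} s r a b → PathLaplacian h z s r a b →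
  sumFrom h s (suc r) ≡ (z s - a) - (b - z (pathEnd s r))
sumFrom-PathLaplacian {h} {z} s zero a b eq = trans (cong (_+ 0ℤ) eq) (single (z s) a b)
  where
  single : ∀ x a b → ((x - a) + (x - b)) + 0ℤ ≡ (x - a) - (b - x)
  single = solve-∀
sumFrom-PathLaplacian {h} {z} s (suc r) a b (eq , rest) =
  trans (cong₂ _+_ eq (sumFrom-PathLaplacian (suc s) r (z s) b rest)) (step (z s) a (z (suc s)) b _)
  where
  step : ∀ x a y b w → ((x - a) + (x - y)) + ((y - x) - (b - w)) ≡ (x - a) - (b - w)
  step = solve-∀

Σℤ≡sumFrom : ∀ {V} (f : Fin V → ℤ) → Σℤ f ≡ sumFrom (ext f) 0 V
Σℤ≡sumFrom {zero}  f = refl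
Σℤ≡sumFrom {suc V} f =
  cong (_+_ (f Fin.zero)) (trans (Σℤ≡sumFrom (λ i → f (Fin.suc i))) (sumFrom-shift (ext f) 0 V))

Σℤ-sub : ∀ {V} (f g : Fin V → ℤ) → Σℤ (λ v → f v - g v) ≡ Σℤ f - Σℤ g
Σℤ-sub {zero}  f g = refl
Σℤ-sub {suc V} f g =
  trans (cong (_+_ (f Fin.zero - g Fin.zero)) (Σℤ-sub (λ i → f (Fin.suc i)) (λ i → g (Fin.suc i))))
        (interchange (f Fin.zero) (g Fin.zero) _ _)
  where
  interchange : ∀ a b c d → (a - b) + (c - d) ≡ (a + c) - (b + d)
  interchange = solve-∀

-- Solving for a potential

-- The Laplacian equation at a vertex v forces the next value of the potential to be
-- 2 z(v) − z(v − 1) − d(v).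
pathPotential : (ℕ → ℤ) → ℕ → ℕ → ℤ → ℤ → ℕ → ℤ
pathPotential d s zero    a u ℓ = ifEq (ℓ ℕ.≟ s) u
pathPotential d s (suc r) a u ℓ = ifEq (ℓ ℕ.≟ s) u + pathPotential d (suc s) r u (u + u - a - d s) ℓ

potentialAfter : (ℕ → ℤ) → ℕ → ℕ → ℤ → ℤ → ℤ
potentialAfter d s zero    a u = u + u - a - d s
potentialAfter d s (suc r) a u = potentialAfter d (suc s) r u (u + u - a - d s)

pathPotential-outside : ∀ d s r a u ℓ → ℓ < s ⊎ pathEnd s r < ℓ → pathPotential d s r a u ℓ ≡ 0ℤ
pathPotential-outside d s zero    a u ℓ (inj₁ ℓ<s)   = ifEq-no u (ℕₚ.<⇒≢ ℓ<s)
pathPotential-outside d s zero    a u ℓ (inj₂ s<ℓ)   = ifEq-no u (ℕₚ.>⇒≢ s<ℓ)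
pathPotential-outside d s (suc r) a u ℓ (inj₁ ℓ<s)   =
  cong₂ _+_ (ifEq-no u (ℕₚ.<⇒≢ ℓ<s))
            (pathPotential-outside d (suc s) r u _ ℓ (inj₁ (ℕₚ.m≤n⇒m≤1+n ℓ<s)))
pathPotential-outside d s (suc r) a u ℓ (inj₂ end<ℓ) =
  cong₂ _+_ (ifEq-no u (ℕₚ.>⇒≢ (ℕₚ.≤-<-trans (≤-pathEnd s (suc r)) end<ℓ)))
            (pathPotential-outside d (suc s) r u _ ℓ (inj₂ end<ℓ))

pathPotential-start : ∀ d s r a u → pathPotential d s r a u s ≡ u
pathPotential-start d s zero    a u = ifEq-yes {s} u refl
pathPotential-start d s (suc r) a u =
  trans (+-vanishʳ (pathPotential-outside d (suc s) r u _ s (inj₁ (ℕₚ.n<1+n s)))) (ifEq-yes {s} u refl)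

pathRecurrence : ∀ u a e → e ≡ (u - a) + (u - (u + u - a - e))
pathRecurrence = solve-∀

pathPotential-PathLaplacian : ∀ d s r a u b → potentialAfter d s r a u ≡ b →
  PathLaplacian d (pathPotential d s r a u) s r a b
pathPotential-PathLaplacian d s zero a u b after≡b =
  trans (pathRecurrence u a (d s))
        (cong₂ (λ x y → (x - a) + (x - y)) (sym (pathPotential-start d s zero a u)) after≡b)
pathPotential-PathLaplacian d s (suc r) a u b after≡b =
  trans (pathRecurrence u a (d s))
        (cong₂ (λ x y → (x - a) + (x - y)) (sym (pathPotential-start d s (suc r) a u)) (sym at-suc-s)) ,
  subst (λ w → PathLaplacian d (pathPotential d s (suc r) a u) (suc s) r w b)
        (sym (pathPotential-start d s (suc r) a u))
        (PathLaplacian-cong-pot (suc s) r u b first-vertex-irrelevant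
          (pathPotential-PathLaplacian d (suc s) r u u′ b after≡b))
  where
  u′ = u + u - a - d s
  first-vertex-irrelevant : ∀ ℓ → InPath (suc s) r ℓ →
    pathPotential d (suc s) r u u′ ℓ ≡ pathPotential d s (suc r) a u ℓ
  first-vertex-irrelevant ℓ (s<ℓ , _) = sym (+-vanishˡ (ifEq-no u (ℕₚ.>⇒≢ s<ℓ)))
  at-suc-s : pathPotential d s (suc r) a u (suc s) ≡ u′
  at-suc-s = trans (sym (first-vertex-irrelevant (suc s) (ℕₚ.≤-refl , ≤-pathEnd (suc s) r)))
                   (pathPotential-start d (suc s) r u u′)

potentialAfter≡ : ∀ d s r a u → potentialAfter d s r a u ≡ + (suc (suc r)) * u - + (suc r) * a - moment d s r
potentialAfter≡ d s zero    a u = single u a (d s)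
  where
  single : ∀ u a e → u + u - a - e ≡ (+ 1 + + 1) * u - + 1 * a - e
  single = solve-∀
potentialAfter≡ d s (suc r) a u =
  trans (potentialAfter≡ d (suc s) r u (u + u - a - d s)) (step (+ (suc r)) u a (d s) (moment d (suc s) r))
  where
  step : ∀ m u a e w → (+ 1 + m) * (u + u - a - e) - m * u - w ≡
                       (+ 1 + (+ 1 + m)) * u - (+ 1 + m) * a - ((+ 1 + m) * e + w)
  step = solve-∀

spokePotentials : ∀ {n} → (ℕ → ℤ) → ℕ → Vec ℕ n → Vec ℤ n → ℕ → ℤ
spokePotentials d s []       []       ℓ = 0ℤ
spokePotentials d s (k ∷ ks) (q ∷ qs) ℓ =
  pathPotential d s (k ∸ 3) 0ℤ q ℓ + spokePotentials d (nextStart s k) ks qs ℓ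

spokePotentials-below : ∀ {n} d s (ks : Vec ℕ n) qs ℓ → ℓ < s → spokePotentials d s ks qs ℓ ≡ 0ℤ
spokePotentials-below d s []       []       ℓ ℓ<s = refl
spokePotentials-below d s (k ∷ ks) (q ∷ qs) ℓ ℓ<s =
  cong₂ _+_ (pathPotential-outside d s (k ∸ 3) 0ℤ q ℓ (inj₁ ℓ<s))
            (spokePotentials-below d (nextStart s k) ks qs ℓ (ℕₚ.<-≤-trans ℓ<s (≤nextStart s k)))

spokePotentials-above : ∀ {n} d s (ks : Vec ℕ n) qs → All (3 ≤_) ks → ∀ ℓ →
  s ℕ.+ internalCount ks ≤ ℓ → spokePotentials d s ks qs ℓ ≡ 0ℤ
spokePotentials-above d s []       []       _            ℓ end≤ℓ = refl
spokePotentials-above d s (k ∷ ks) (q ∷ qs) (3≤k ∷ ks≥3) ℓ end≤ℓ =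
  cong₂ _+_ (pathPotential-outside d s (k ∸ 3) 0ℤ q ℓ
              (inj₂ (ℕₚ.<-≤-trans (pathEnd<nextStart 3≤k s) (ℕₚ.≤-trans (ℕₚ.m≤m+n _ (internalCount ks)) end′≤ℓ))))
            (spokePotentials-above d (nextStart s k) ks qs ks≥3 ℓ end′≤ℓ)
  where
  end′≤ℓ : nextStart s k ℕ.+ internalCount ks ≤ ℓ
  end′≤ℓ = subst (_≤ ℓ) (sym (nextStart-+-internalCount s k ks)) end≤ℓ

module _ (d : ℕ → ℤ) {s k : ℕ} (3≤k : 3 ≤ k) {n} (ks : Vec ℕ n) (q : ℤ) (qs : Vec ℤ n) where

  spokePotentials-head : ∀ ℓ → ℓ ≤ pathEnd s (k ∸ 3) →
    spokePotentials d s (k ∷ ks) (q ∷ qs) ℓ ≡ pathPotential d s (k ∸ 3) 0ℤ q ℓ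
  spokePotentials-head ℓ ℓ≤end =
    +-vanishʳ (spokePotentials-below d (nextStart s k) ks qs ℓ (ℕₚ.≤-<-trans ℓ≤end (pathEnd<nextStart 3≤k s)))

  spokePotentials-tail : ∀ ℓ → nextStart s k ≤ ℓ →
    spokePotentials d s (k ∷ ks) (q ∷ qs) ℓ ≡ spokePotentials d (nextStart s k) ks qs ℓ
  spokePotentials-tail ℓ next≤ℓ =
    +-vanishˡ (pathPotential-outside d s (k ∸ 3) 0ℤ q ℓ (inj₂ (ℕₚ.<-≤-trans (pathEnd<nextStart 3≤k s) next≤ℓ)))

spokePotentials-PathLaplacians : ∀ {n} d s (ks : Vec ℕ n) qs T z → All (3 ≤_) ks →
  (∀ ℓ → s ≤ ℓ → z ℓ ≡ spokePotentials d s ks qs ℓ) →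
  ΛCoords T ks (moments d s ks) qs → PathLaplacians d z s ks 0ℤ T
spokePotentials-PathLaplacians d s []       []       T z _            z≗ tt                  = tt
spokePotentials-PathLaplacians d s (k ∷ ks) (q ∷ qs) T z (3≤k ∷ ks≥3) z≗ (coord , coords) =
  PathLaplacian-cong-pot s (k ∸ 3) 0ℤ T on-path (pathPotential-PathLaplacian d s (k ∸ 3) 0ℤ q T reaches-T) ,
  spokePotentials-PathLaplacians d (nextStart s k) ks qs T z ks≥3
    (λ ℓ next≤ℓ → trans (z≗ ℓ (ℕₚ.≤-trans (≤nextStart s k) next≤ℓ)) (spokePotentials-tail d 3≤k ks q qs ℓ next≤ℓ))
    coords
  where
  m = + suc (suc (k ∸ 3))
  solved : ∀ m m′ q T → m * q - m′ * 0ℤ - (- T + m * q) ≡ T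
  solved = solve-∀
  reaches-T : potentialAfter d s (k ∸ 3) 0ℤ q ≡ T
  reaches-T = begin
    potentialAfter d s (k ∸ 3) 0ℤ q
      ≡⟨ potentialAfter≡ d s (k ∸ 3) 0ℤ q ⟩
    m * q - + suc (k ∸ 3) * 0ℤ - moment d s (k ∸ 3)
      ≡⟨ cong (λ w → m * q - + suc (k ∸ 3) * 0ℤ - w) (trans coord (cong (λ j → - T + + j * q) (k∸1≡ 3≤k))) ⟩
    m * q - + suc (k ∸ 3) * 0ℤ - (- T + m * q)
      ≡⟨ solved m (+ suc (k ∸ 3)) q T ⟩
    T ∎
    where open ≡-Reasoning
  on-path : ∀ ℓ → InPath s (k ∸ 3) ℓ → pathPotential d s (k ∸ 3) 0ℤ q ℓ ≡ z ℓ
  on-path ℓ (s≤ℓ , ℓ≤end) = sym (trans (z≗ ℓ s≤ℓ) (spokePotentials-head d 3≤k ks q qs ℓ ℓ≤end))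

startOffsets-spokePotentials : ∀ {n} d s (ks : Vec ℕ n) qs z → All (3 ≤_) ks →
  (∀ ℓ → s ≤ ℓ → z ℓ ≡ spokePotentials d s ks qs ℓ) → startOffsets z s ks 0ℤ ≡ qs
startOffsets-spokePotentials d s []       []       z _            z≗ = refl
startOffsets-spokePotentials d s (k ∷ ks) (q ∷ qs) z (3≤k ∷ ks≥3) z≗ =
  cong₂ _∷_ (trans (ℤₚ.+-identityʳ (z s))
                   (trans (z≗ s ℕₚ.≤-refl)
                          (trans (spokePotentials-head d 3≤k ks q qs s (≤-pathEnd s (k ∸ 3)))
                                 (pathPotential-start d s (k ∸ 3) 0ℤ q))))
            (startOffsets-spokePotentials d (nextStart s k) ks qs z ks≥3
              (λ ℓ next≤ℓ → trans (z≗ ℓ (ℕₚ.≤-trans (≤nextStart s k) next≤ℓ))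
                                  (spokePotentials-tail d 3≤k ks q qs ℓ next≤ℓ)))

PathLaplacian-unique : ∀ {h h′ z} s r a b → PathLaplacian h z s r a b → PathLaplacian h′ z s r a b →
  ∀ ℓ → InPath s r ℓ → h ℓ ≡ h′ ℓ
PathLaplacian-unique s zero a b eq eq′ ℓ (s≤ℓ , ℓ≤s) with ℕₚ.≤-antisym s≤ℓ ℓ≤s
... | refl = trans eq (sym eq′)
PathLaplacian-unique {z = z} s (suc r) a b (eq , rest) (eq′ , rest′) ℓ (s≤ℓ , ℓ≤end) with s ℕ.≟ ℓ
... | yes refl = trans eq (sym eq′)
... | no  s≢ℓ  = PathLaplacian-unique (suc s) r (z s) b rest rest′ ℓ (ℕₚ.≤∧≢⇒< s≤ℓ s≢ℓ , ℓ≤end)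

PathLaplacians-unique : ∀ {n} {h h′ z} s (ks : Vec ℕ n) a b → All (3 ≤_) ks →
  PathLaplacians h z s ks a b → PathLaplacians h′ z s ks a b →
  ∀ ℓ → s ≤ ℓ → ℓ < s ℕ.+ internalCount ks → h ℓ ≡ h′ ℓ
PathLaplacians-unique s [] a b _ _ _ ℓ s≤ℓ ℓ<s+0 =
  ⊥-elim (ℕₚ.<-irrefl refl (ℕₚ.≤-<-trans s≤ℓ (subst (ℓ <_) (ℕₚ.+-identityʳ s) ℓ<s+0)))
PathLaplacians-unique s (k ∷ ks) a b (3≤k ∷ ks≥3) (path , paths) (path′ , paths′) ℓ s≤ℓ ℓ<end
  with ℓ ℕ.<? nextStart s k
... | yes ℓ<next = PathLaplacian-unique s (k ∸ 3) a b path path′ ℓ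
                     (s≤ℓ , <nextStart⇒≤pathEnd 3≤k s ℓ<next)
... | no  ℓ≮next = PathLaplacians-unique (nextStart s k) ks a b ks≥3 paths paths′ ℓ (ℕₚ.≮⇒≥ ℓ≮next)
                     (subst (ℓ <_) (sym (nextStart-+-internalCount s k ks)) ℓ<end)

spokesAtY-PathLaplacians : ∀ {n} h z s (ks : Vec ℕ n) a → All (3 ≤_) ks → PathLaplacians h z s ks a (z 1) →
  spokesAtY z s ks ≡ sumℤ (startOffsets z s ks a) - spokeSums h s ks
spokesAtY-PathLaplacians h z s []       a _            tt            = refl
spokesAtY-PathLaplacians h z s (k ∷ ks) a (3≤k ∷ ks≥3) (path , paths) = begin
  (z 1 - z end) + spokesAtY z next ks
    ≡⟨ cong (_+_ (z 1 - z end)) (spokesAtY-PathLaplacians h z next ks a ks≥3 paths) ⟩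
  (z 1 - z end) + (sumℤ (startOffsets z next ks a) - spokeSums h next ks)
    ≡⟨ regroup (z 1) (z end) (z s) a _ _ ⟩
  ((z s - a) + sumℤ (startOffsets z next ks a)) - (((z s - a) - (z 1 - z end)) + spokeSums h next ks)
    ≡⟨ cong (λ w → ((z s - a) + sumℤ (startOffsets z next ks a)) - (w + spokeSums h next ks)) (sym path-sum) ⟩
  ((z s - a) + sumℤ (startOffsets z next ks a)) - (sumFrom h s (k ∸ 2) + spokeSums h next ks) ∎
  where
  open ≡-Reasoning
  end  = pathEnd s (k ∸ 3)
  next = nextStart s k
  regroup : ∀ y w x a Q S → (y - w) + (Q - S) ≡ ((x - a) + Q) - (((x - a) - (y - w)) + S)
  regroup = solve-∀
  path-sum : sumFrom h s (k ∸ 2) ≡ (z s - a) - (z 1 - z end)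
  path-sum = trans (cong (sumFrom h s) (k∸2≡ 3≤k)) (sumFrom-PathLaplacian s (k ∸ 3) a (z 1) path)

potentialFor : ∀ {n} → Vec ℕ n → (ℕ → ℤ) → ℤ → Vec ℤ n → ℕ → ℤ
potentialFor ks d T qs zero          = 0ℤ
potentialFor ks d T qs (suc zero)    = T
potentialFor ks d T qs (suc (suc ℓ)) = spokePotentials d 2 ks qs (suc (suc ℓ))

potentialFor-spokes : ∀ {n} (ks : Vec ℕ n) d T qs ℓ → 2 ≤ ℓ →
  potentialFor ks d T qs ℓ ≡ spokePotentials d 2 ks qs ℓ
potentialFor-spokes ks d T qs (suc (suc ℓ)) (s≤s (s≤s _)) = refl

potentialFor-outside : ∀ {n} (ks : Vec ℕ n) → All (3 ≤_) ks → ∀ d T qs ℓ → V (hinge ks) ≤ ℓ →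
  potentialFor ks d T qs ℓ ≡ 0ℤ
potentialFor-outside ks ks≥3 d T qs ℓ V≤ℓ =
  trans (potentialFor-spokes ks d T qs ℓ (ℕₚ.≤-trans (ℕₚ.m≤m+n 2 _) V≤ℓ))
        (spokePotentials-above d 2 ks qs ks≥3 ℓ V≤ℓ)

module _ {n} (ks : Vec ℕ n) (ks≥3 : All (3 ≤_) ks) (d : ℕ → ℤ) (T : ℤ) (qs : Vec ℤ n)
         (coords : ΛCoords T ks (moments d 2 ks) qs) where

  private
    p = potentialFor ks d T qs
    on-spokes : ∀ ℓ → 2 ≤ ℓ → p ℓ ≡ spokePotentials d 2 ks qs ℓ
    on-spokes = potentialFor-spokes ks d T qs
    paths : PathLaplacians d p 2 ks 0ℤ T
    paths = spokePotentials-PathLaplacians d 2 ks qs T p ks≥3 on-spokes coords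
    offsets : startOffsets p 2 ks 0ℤ ≡ qs
    offsets = startOffsets-spokePotentials d 2 ks qs p ks≥3 on-spokes

  laplacianℕ-potentialFor-x : d 0 ≡ - T - sumℤ qs →
    laplacianℕ (edges (hinge ks)) (potentialFor ks d T qs) 0 ≡ d 0
  laplacianℕ-potentialFor-x x-coord = begin
    laplacianℕ (edges (hinge ks)) p 0          ≡⟨ laplacianℕ-hinge-x p ks ⟩
    (0ℤ - T) + spokesAtX p 2 ks                ≡⟨ cong (_+_ (0ℤ - T)) (spokesAtX≡-sumℤ p 2 ks) ⟩
    (0ℤ - T) + - sumℤ (startOffsets p 2 ks 0ℤ) ≡⟨ cong (λ w → (0ℤ - T) + - sumℤ w) offsets ⟩
    (0ℤ - T) + - sumℤ qs                       ≡⟨ regroup T (sumℤ qs) ⟩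
    - T - sumℤ qs                              ≡⟨ sym x-coord ⟩
    d 0                                        ∎
    where
    open ≡-Reasoning
    regroup : ∀ T S → (0ℤ - T) + - S ≡ - T - S
    regroup = solve-∀

  laplacianℕ-potentialFor-y : d 0 + (d 1 + spokeSums d 2 ks) ≡ 0ℤ → d 0 ≡ - T - sumℤ qs →
    laplacianℕ (edges (hinge ks)) (potentialFor ks d T qs) 1 ≡ d 1
  laplacianℕ-potentialFor-y degree x-coord = begin
    laplacianℕ (edges (hinge ks)) p 1                              ≡⟨ laplacianℕ-hinge-y p ks ⟩
    (T - 0ℤ) + spokesAtY p 2 ks
      ≡⟨ cong (_+_ (T - 0ℤ)) (spokesAtY-PathLaplacians d p 2 ks 0ℤ ks≥3 paths) ⟩
    (T - 0ℤ) + (sumℤ (startOffsets p 2 ks 0ℤ) - spokeSums d 2 ks)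
      ≡⟨ cong (λ w → (T - 0ℤ) + (sumℤ w - spokeSums d 2 ks)) offsets ⟩
    (T - 0ℤ) + (sumℤ qs - spokeSums d 2 ks)                        ≡⟨ simplify T (sumℤ qs) _ ⟩
    0ℤ - (- T - sumℤ qs) - spokeSums d 2 ks
      ≡⟨ cong₂ (λ a b → a - b - spokeSums d 2 ks) (sym degree) (sym x-coord) ⟩
    (d 0 + (d 1 + spokeSums d 2 ks)) - d 0 - spokeSums d 2 ks      ≡⟨ isolate (d 0) (d 1) _ ⟩
    d 1                                                            ∎
    where
    open ≡-Reasoning
    simplify : ∀ T Q S → (T - 0ℤ) + (Q - S) ≡ 0ℤ - (- T - Q) - S
    simplify = solve-∀
    isolate : ∀ d₀ d₁ S → (d₀ + (d₁ + S)) - d₀ - S ≡ d₁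
    isolate = solve-∀

  laplacianℕ-potentialFor-spokes : ∀ ℓ → 2 ≤ ℓ → ℓ < V (hinge ks) →
    laplacianℕ (edges (hinge ks)) (potentialFor ks d T qs) ℓ ≡ d ℓ
  laplacianℕ-potentialFor-spokes ℓ 2≤ℓ ℓ<V =
    PathLaplacians-unique 2 ks 0ℤ T ks≥3 (laplacianℕ-hinge-paths p ks ks≥3) paths ℓ 2≤ℓ ℓ<V

Ψ∈Λ⇒principal : ∀ {n} (ks : Vec ℕ n) → All (3 ≤_) ks → (δ : Divisor (hinge ks)) → Σℤ δ ≡ 0ℤ →
  Ψ ks (ext δ) ∈Λ ks → ∃ λ (z : Fin (V (hinge ks)) → ℤ) → ∀ v → δ v ≡ laplacian (hinge ks) z v
Ψ∈Λ⇒principal ks ks≥3 δ deg≡0 (T , qs , coords , x-coord) = (λ v → p (toℕ v)) , δ≡Lp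
  where
  d = ext δ
  p = potentialFor ks d T qs
  degree : d 0 + (d 1 + spokeSums d 2 ks) ≡ 0ℤ
  degree = trans (cong (λ w → d 0 + (d 1 + w)) (sym (sumFrom-internalCount d 2 ks)))
                 (trans (sym (Σℤ≡sumFrom δ)) deg≡0)
  L≡d : ∀ ℓ → ℓ < V (hinge ks) → laplacianℕ (edges (hinge ks)) p ℓ ≡ d ℓ
  L≡d zero          _   = laplacianℕ-potentialFor-x ks ks≥3 d T qs coords x-coord
  L≡d (suc zero)    _   = laplacianℕ-potentialFor-y ks ks≥3 d T qs coords degree x-coord
  L≡d (suc (suc ℓ)) ℓ<V = laplacianℕ-potentialFor-spokes ks ks≥3 d T qs coords (suc (suc ℓ)) (s≤s (s≤s z≤n)) ℓ<V
  δ≡Lp : ∀ v → δ v ≡ laplacian (hinge ks) (λ v → p (toℕ v)) v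
  δ≡Lp v = begin
    δ v                                       ≡⟨ sym (ext-toℕ δ v) ⟩
    d (toℕ v)                                 ≡⟨ sym (L≡d (toℕ v) (Finₚ.toℕ<n v)) ⟩
    laplacianℕ (edges (hinge ks)) p (toℕ v)
      ≡⟨ sym (laplacian-labels (hinge ks) p (potentialFor-outside ks ks≥3 d T qs) v) ⟩
    laplacian (hinge ks) (λ v → p (toℕ v)) v  ∎
    where open ≡-Reasoning

_-ᵖ_ : ∀ {n} → ℤ × Vec ℤ n → ℤ × Vec ℤ n → ℤ × Vec ℤ n
(e , cs) -ᵖ (e′ , cs′) = e - e′ , zipWith _-_ cs cs′

moment-sub : ∀ (f g : ℕ → ℤ) s r → moment (λ ℓ → f ℓ - g ℓ) s r ≡ moment f s r - moment g s r
moment-sub f g s zero    = refl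
moment-sub f g s (suc r) =
  trans (cong (_+_ (+ suc (suc r) * (f s - g s))) (moment-sub f g (suc s) r))
        (distrib (+ suc (suc r)) (f s) (g s) (moment f (suc s) r) (moment g (suc s) r))
  where
  distrib : ∀ m a b x y → m * (a - b) + (x - y) ≡ (m * a + x) - (m * b + y)
  distrib = solve-∀

moments-sub : ∀ {n} (f g : ℕ → ℤ) s (ks : Vec ℕ n) →
  moments (λ ℓ → f ℓ - g ℓ) s ks ≡ zipWith _-_ (moments f s ks) (moments g s ks)
moments-sub f g s []       = refl
moments-sub f g s (k ∷ ks) = cong₂ _∷_ (moment-sub f g s (k ∸ 3)) (moments-sub f g (nextStart s k) ks)

moment-cong : ∀ {d d′} s r → (∀ ℓ → d ℓ ≡ d′ ℓ) → moment d s r ≡ moment d′ s r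
moment-cong s zero    d≗d′ = d≗d′ s
moment-cong s (suc r) d≗d′ = cong₂ (λ u w → + suc (suc r) * u + w) (d≗d′ s) (moment-cong (suc s) r d≗d′)

moments-cong : ∀ {n} {d d′} s (ks : Vec ℕ n) → (∀ ℓ → d ℓ ≡ d′ ℓ) → moments d s ks ≡ moments d′ s ks
moments-cong s []       d≗d′ = refl
moments-cong s (k ∷ ks) d≗d′ = cong₂ _∷_ (moment-cong s (k ∸ 3) d≗d′) (moments-cong (nextStart s k) ks d≗d′)

Ψ-cong : ∀ {n} (ks : Vec ℕ n) {d d′} → (∀ ℓ → d ℓ ≡ d′ ℓ) → Ψ ks d ≡ Ψ ks d′
Ψ-cong ks d≗d′ = cong₂ _,_ (d≗d′ 0) (moments-cong 2 ks d≗d′)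

Ψ-ext-sub : ∀ {n} (ks : Vec ℕ n) {V} (f g : Fin V → ℤ) →
  Ψ ks (ext (λ v → f v - g v)) ≡ Ψ ks (ext f) -ᵖ Ψ ks (ext g)
Ψ-ext-sub ks f g =
  trans (Ψ-cong ks (ext-sub f g)) (cong (ext f 0 - ext g 0 ,_) (moments-sub (ext f) (ext g) 2 ks))

record ConcentratedAtEnd (g : ℕ → ℤ) (s r : ℕ) (c : ℤ) : Set where
  constructor concentrated
  field
    before : ∀ ℓ → s ≤ ℓ → ℓ < pathEnd s r → g ℓ ≡ 0ℤ
    at-end : g (pathEnd s r) ≡ c

ConcentratedAtEnd-suc : ∀ {g s r c} → ConcentratedAtEnd g s (suc r) c → ConcentratedAtEnd g (suc s) r c
ConcentratedAtEnd-suc (concentrated before at-end) = concentrated (λ ℓ s<ℓ → before ℓ (ℕₚ.<⇒≤ s<ℓ)) at-end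

first-vanishes : ∀ {g s r c} → ConcentratedAtEnd g s (suc r) c → g s ≡ 0ℤ
first-vanishes {s = s} {r} (concentrated before _) =
  before s ℕₚ.≤-refl (ℕₚ.<-≤-trans (ℕₚ.n<1+n s) (≤-pathEnd (suc s) r))

moment-concentrated : ∀ g s r c → ConcentratedAtEnd g s r c → moment g s r ≡ c
moment-concentrated g s zero    c (concentrated _ at-end) = at-end
moment-concentrated g s (suc r) c conc =
  trans (cong₂ _+_ (trans (cong (_*_ (+ suc (suc r))) (first-vanishes conc)) (ℤₚ.*-zeroʳ (+ suc (suc r))))
                   (moment-concentrated g (suc s) r c (ConcentratedAtEnd-suc conc)))
        (ℤₚ.+-identityˡ c)

sumFrom-concentrated : ∀ g s r c → ConcentratedAtEnd g s r c → sumFrom g s (suc r) ≡ c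
sumFrom-concentrated g s zero    c (concentrated _ at-end) = trans (ℤₚ.+-identityʳ _) at-end
sumFrom-concentrated g s (suc r) c conc =
  trans (+-vanishˡ (first-vanishes conc)) (sumFrom-concentrated g (suc s) r c (ConcentratedAtEnd-suc conc))

atPathEnds : ∀ {n} → ℕ → Vec ℕ n → Vec ℤ n → ℕ → ℤ
atPathEnds s []       []       ℓ = 0ℤ
atPathEnds s (k ∷ ks) (c ∷ cs) ℓ = ifEq (ℓ ℕ.≟ pathEnd s (k ∸ 3)) c + atPathEnds (nextStart s k) ks cs ℓ

atPathEnds-below : ∀ {n} s (ks : Vec ℕ n) cs ℓ → ℓ < s → atPathEnds s ks cs ℓ ≡ 0ℤ
atPathEnds-below s []       []       ℓ ℓ<s = refl
atPathEnds-below s (k ∷ ks) (c ∷ cs) ℓ ℓ<s =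
  cong₂ _+_ (ifEq-no c (ℕₚ.<⇒≢ (ℕₚ.<-≤-trans ℓ<s (≤-pathEnd s (k ∸ 3)))))
            (atPathEnds-below (nextStart s k) ks cs ℓ (ℕₚ.<-≤-trans ℓ<s (≤nextStart s k)))

atPathEnds-above : ∀ {n} s (ks : Vec ℕ n) cs → All (3 ≤_) ks → ∀ ℓ →
  s ℕ.+ internalCount ks ≤ ℓ → atPathEnds s ks cs ℓ ≡ 0ℤ
atPathEnds-above s []       []       _            ℓ end≤ℓ = refl
atPathEnds-above s (k ∷ ks) (c ∷ cs) (3≤k ∷ ks≥3) ℓ end≤ℓ =
  cong₂ _+_ (ifEq-no c (ℕₚ.>⇒≢ (ℕₚ.<-≤-trans (pathEnd<nextStart 3≤k s)
                                  (ℕₚ.≤-trans (ℕₚ.m≤m+n _ (internalCount ks)) end′≤ℓ))))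
            (atPathEnds-above (nextStart s k) ks cs ks≥3 ℓ end′≤ℓ)
  where
  end′≤ℓ : nextStart s k ℕ.+ internalCount ks ≤ ℓ
  end′≤ℓ = subst (_≤ ℓ) (sym (nextStart-+-internalCount s k ks)) end≤ℓ

module _ (g : ℕ → ℤ) {s k : ℕ} (3≤k : 3 ≤ k) {n} (ks : Vec ℕ n) (c : ℤ) (cs : Vec ℤ n)
         (g≗ : ∀ ℓ → s ≤ ℓ → g ℓ ≡ atPathEnds s (k ∷ ks) (c ∷ cs) ℓ) where

  atPathEnds-head : ConcentratedAtEnd g s (k ∸ 3) c
  atPathEnds-head = concentrated
    (λ ℓ s≤ℓ ℓ<end → trans (g≗ ℓ s≤ℓ)
       (trans (+-vanishʳ (atPathEnds-below (nextStart s k) ks cs ℓ (ℕₚ.<-trans ℓ<end (pathEnd<nextStart 3≤k s))))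
              (ifEq-no c (ℕₚ.<⇒≢ ℓ<end))))
    (trans (g≗ _ (≤-pathEnd s (k ∸ 3)))
          (trans (+-vanishʳ (atPathEnds-below (nextStart s k) ks cs _ (pathEnd<nextStart 3≤k s)))
                 (ifEq-yes {pathEnd s (k ∸ 3)} c refl)))

  atPathEnds-tail : ∀ ℓ → nextStart s k ≤ ℓ → g ℓ ≡ atPathEnds (nextStart s k) ks cs ℓ
  atPathEnds-tail ℓ next≤ℓ =
    trans (g≗ ℓ (ℕₚ.≤-trans (≤nextStart s k) next≤ℓ))
          (+-vanishˡ (ifEq-no c (ℕₚ.>⇒≢ (ℕₚ.<-≤-trans (pathEnd<nextStart 3≤k s) next≤ℓ))))

moments-atPathEnds : ∀ {n} g s (ks : Vec ℕ n) cs → All (3 ≤_) ks →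
  (∀ ℓ → s ≤ ℓ → g ℓ ≡ atPathEnds s ks cs ℓ) → moments g s ks ≡ cs
moments-atPathEnds g s []       []       _            g≗ = refl
moments-atPathEnds g s (k ∷ ks) (c ∷ cs) (3≤k ∷ ks≥3) g≗ =
  cong₂ _∷_ (moment-concentrated g s (k ∸ 3) c (atPathEnds-head g 3≤k ks c cs g≗))
            (moments-atPathEnds g (nextStart s k) ks cs ks≥3 (atPathEnds-tail g 3≤k ks c cs g≗))

spokeSums-atPathEnds : ∀ {n} g s (ks : Vec ℕ n) cs → All (3 ≤_) ks →
  (∀ ℓ → s ≤ ℓ → g ℓ ≡ atPathEnds s ks cs ℓ) → spokeSums g s ks ≡ sumℤ cs
spokeSums-atPathEnds g s []       []       _            g≗ = refl
spokeSums-atPathEnds g s (k ∷ ks) (c ∷ cs) (3≤k ∷ ks≥3) g≗ =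
  cong₂ _+_ (trans (cong (sumFrom g s) (k∸2≡ 3≤k))
                   (sumFrom-concentrated g s (k ∸ 3) c (atPathEnds-head g 3≤k ks c cs g≗)))
            (spokeSums-atPathEnds g (nextStart s k) ks cs ks≥3 (atPathEnds-tail g 3≤k ks c cs g≗))

-- cᵢ sits at distance 1 from y, so it is the i-th moment
divisorℕ : ∀ {n} → Vec ℕ n → ℤ × Vec ℤ n → ℕ → ℤ
divisorℕ ks (e , cs) zero          = e
divisorℕ ks (e , cs) (suc zero)    = - (e + sumℤ cs)
divisorℕ ks (e , cs) (suc (suc ℓ)) = atPathEnds 2 ks cs (suc (suc ℓ))

divisorℕ-spokes : ∀ {n} (ks : Vec ℕ n) x ℓ → 2 ≤ ℓ → divisorℕ ks x ℓ ≡ atPathEnds 2 ks (proj₂ x) ℓ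
divisorℕ-spokes ks (e , cs) (suc (suc ℓ)) (s≤s (s≤s _)) = refl

divisorOf : ∀ {n} (ks : Vec ℕ n) → ℤ × Vec ℤ n → Divisor (hinge ks)
divisorOf ks x v = divisorℕ ks x (toℕ v)

module _ {n} (ks : Vec ℕ n) (ks≥3 : All (3 ≤_) ks) where

  ext-divisorOf : ∀ x ℓ → ext (divisorOf ks x) ℓ ≡ divisorℕ ks x ℓ
  ext-divisorOf x = ext-unique (divisorOf ks x) (divisorℕ ks x) (λ _ → refl)
    (λ ℓ V≤ℓ → trans (divisorℕ-spokes ks x ℓ (ℕₚ.≤-trans (ℕₚ.m≤m+n 2 _) V≤ℓ))
                     (atPathEnds-above 2 ks (proj₂ x) ks≥3 ℓ V≤ℓ))

  Ψ-divisorOf : ∀ x → Ψ ks (ext (divisorOf ks x)) ≡ x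
  Ψ-divisorOf (e , cs) =
    trans (Ψ-cong ks (ext-divisorOf (e , cs)))
          (cong (e ,_) (moments-atPathEnds (divisorℕ ks (e , cs)) 2 ks cs ks≥3 (divisorℕ-spokes ks (e , cs))))

  Σℤ-divisorOf : ∀ x → Σℤ (divisorOf ks x) ≡ 0ℤ
  Σℤ-divisorOf (e , cs) = begin
    Σℤ (divisorOf ks (e , cs))
      ≡⟨ Σℤ≡sumFrom (divisorOf ks (e , cs)) ⟩
    sumFrom (ext (divisorOf ks (e , cs))) 0 (V (hinge ks))
      ≡⟨ sumFrom-cong 0 (V (hinge ks)) (ext-divisorOf (e , cs)) ⟩
    e + (- (e + sumℤ cs) + sumFrom (divisorℕ ks (e , cs)) 2 (internalCount ks))
      ≡⟨ cong (λ w → e + (- (e + sumℤ cs) + w)) spokes ⟩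
    e + (- (e + sumℤ cs) + sumℤ cs)
      ≡⟨ cancel e (sumℤ cs) ⟩
    0ℤ ∎
    where
    open ≡-Reasoning
    spokes : sumFrom (divisorℕ ks (e , cs)) 2 (internalCount ks) ≡ sumℤ cs
    spokes = trans (sumFrom-internalCount _ 2 ks)
                   (spokeSums-atPathEnds _ 2 ks cs ks≥3 (divisorℕ-spokes ks (e , cs)))
    cancel : ∀ e S → e + (- (e + S) + S) ≡ 0ℤ
    cancel = solve-∀

-- Canonical representatives modulo Λ

ℕPoint : ℕ → Set
ℕPoint n = ℕ × Vec ℕ n

toℤ : ∀ {n} → ℕPoint n → ℤ × Vec ℤ n
toℤ (e , rs) = + e , map +_ rs

InBox : ∀ {n} → Vec ℕ n → Vec ℕ n → Set
InBox []       []       = ⊤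
InBox (k ∷ ks) (r ∷ rs) = r < k ∸ 1 × InBox ks rs

#zeros : ∀ {n} → Vec ℕ n → ℕ
#zeros []            = 0
#zeros (zero  ∷ rs) = suc (#zeros rs)
#zeros (suc _ ∷ rs) = #zeros rs

Canonical : ∀ {n} → Vec ℕ n → ℕPoint n → Set
Canonical ks (e , rs) = InBox ks rs × e ≤ #zeros rs

pos-sub-injective : ∀ a b c d → + a - + b ≡ + c - + d → a ℕ.+ d ≡ c ℕ.+ b
pos-sub-injective a b c d eq = ℤₚ.+-injective (begin
  + a + + d                 ≡⟨ move (+ a) (+ b) (+ d) ⟩
  (+ a - + b) + + d + + b   ≡⟨ cong (λ x → x + + d + + b) eq ⟩
  (+ c - + d) + + d + + b   ≡⟨ cancel (+ c) (+ b) (+ d) ⟩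
  + c + + b                 ∎)
  where
  open ≡-Reasoning
  move : ∀ x b d → x + d ≡ (x - b) + d + b
  move = solve-∀
  cancel : ∀ c b d → (c - d) + d + b ≡ c + b
  cancel = solve-∀

coord-pos : ∀ T m n → - T + + m * + n ≡ + (m ℕ.* n) - T
coord-pos T m n = trans (cong (_+_ (- T)) (sym (ℤₚ.pos-* m n))) (ℤₚ.+-comm (- T) _)

coord-neg : ∀ t m j → - + t + + m * -[1+ j ] ≡ 0ℤ - + (t ℕ.+ m ℕ.* suc j)
coord-neg t m j = begin
  - + t + + m * -[1+ j ]        ≡⟨ cong (_+_ (- + t)) (sym (ℤₚ.neg-distribʳ-* (+ m) (+ suc j))) ⟩
  - + t + - (+ m * + suc j)     ≡⟨ cong (λ w → - + t + - w) (sym (ℤₚ.pos-* m (suc j))) ⟩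
  - + t + - + (m ℕ.* suc j)     ≡⟨ negate (+ t) _ ⟩
  0ℤ - (+ t + + (m ℕ.* suc j))  ≡⟨ cong (_-_ 0ℤ) (sym (ℤₚ.pos-+ t (m ℕ.* suc j))) ⟩
  0ℤ - + (t ℕ.+ m ℕ.* suc j)    ∎
  where
  open ≡-Reasoning
  negate : ∀ a b → - a + - b ≡ 0ℤ - (a + b)
  negate = solve-∀

module _ (m : ℕ) {r r′ : ℕ} (r<m : r < m) (r′<m : r′ < m) where
  open ℕₚ.≤-Reasoning

  private
    overshoot : ∀ t M → m ≤ M → r ℕ.+ (t ℕ.+ M) ≡ r′ → ⊥
    overshoot t M m≤M eq = ℕₚ.<-irrefl refl (begin-strict
      m                  ≤⟨ m≤M ⟩
      M                  ≤⟨ ℕₚ.m≤n+m M t ⟩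
      t ℕ.+ M            ≤⟨ ℕₚ.m≤n+m _ r ⟩
      r ℕ.+ (t ℕ.+ M)    ≡⟨ eq ⟩
      r′                 <⟨ r′<m ⟩
      m                  ∎)

  offset-pos : ∀ t q → + r - + r′ ≡ - + suc t + + m * q → ∃ λ j → q ≡ + j × (r′ ≡ 0 → 1 ≤ j)
  offset-pos t (+ zero) eq = 0 , refl , λ r′≡0 → ⊥-elim (ℕₚ.m+1+n≢0 r (begin-equality
    r ℕ.+ suc t        ≡⟨ pos-sub-injective r r′ (m ℕ.* 0) (suc t) (trans eq (coord-pos (+ suc t) m 0)) ⟩
    m ℕ.* 0 ℕ.+ r′     ≡⟨ cong₂ ℕ._+_ (ℕₚ.*-zeroʳ m) r′≡0 ⟩
    0                  ∎))
  offset-pos t (+ suc j) eq = suc j , refl , λ _ → s≤s z≤n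
  offset-pos t -[1+ j ]  eq = ⊥-elim (overshoot (suc t) (m ℕ.* suc j) (ℕₚ.m≤m*n m (suc j))
    (pos-sub-injective r r′ 0 _ (trans eq (coord-neg (suc t) m j))))

  offset-zero : ∀ q → + r - + r′ ≡ - 0ℤ + + m * q → q ≡ 0ℤ × r ≡ r′
  offset-zero (+ zero) eq = refl , (begin-equality
    r                  ≡⟨ sym (ℕₚ.+-identityʳ r) ⟩
    r ℕ.+ 0            ≡⟨ pos-sub-injective r r′ (m ℕ.* 0) 0 (trans eq (coord-pos 0ℤ m 0)) ⟩
    m ℕ.* 0 ℕ.+ r′     ≡⟨ cong (ℕ._+ r′) (ℕₚ.*-zeroʳ m) ⟩
    r′                 ∎)
  offset-zero (+ suc j) eq = ⊥-elim (ℕₚ.<-irrefl refl (begin-strict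
    m                  ≤⟨ ℕₚ.m≤m*n m (suc j) ⟩
    m ℕ.* suc j        ≤⟨ ℕₚ.m≤m+n _ r′ ⟩
    m ℕ.* suc j ℕ.+ r′ ≡⟨ sym (pos-sub-injective r r′ (m ℕ.* suc j) 0 (trans eq (coord-pos 0ℤ m (suc j)))) ⟩
    r ℕ.+ 0            ≡⟨ ℕₚ.+-identityʳ r ⟩
    r                  <⟨ r<m ⟩
    m                  ∎))
  offset-zero -[1+ j ] eq = ⊥-elim (overshoot 0 (m ℕ.* suc j) (ℕₚ.m≤m*n m (suc j))
    (pos-sub-injective r r′ 0 _ (trans eq (coord-neg 0 m j))))

ΛCoords-pos : ∀ {n} (ks : Vec ℕ n) rs rs′ qs t → InBox ks rs → InBox ks rs′ →
  ΛCoords (+ suc t) ks (zipWith _-_ (map +_ rs) (map +_ rs′)) qs →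
  ∃ λ N → sumℤ qs ≡ + N × #zeros rs′ ≤ N
ΛCoords-pos [] [] [] [] t _ _ _ = 0 , refl , z≤n
ΛCoords-pos (k ∷ ks) (r ∷ rs) (r′ ∷ rs′) (q ∷ qs) t (r<m , box) (r′<m , box′) (coord , coords)
  with offset-pos (k ∸ 1) r<m r′<m t q coord | ΛCoords-pos ks rs rs′ qs t box box′ coords
... | j , refl , zero⇒1≤j | N , sum≡N , zeros≤N =
  j ℕ.+ N , trans (cong (_+_ (+ j)) sum≡N) (sym (ℤₚ.pos-+ j N)) , zeros-step r′ zero⇒1≤j
  where
  zeros-step : ∀ r′ → (r′ ≡ 0 → 1 ≤ j) → #zeros (r′ ∷ rs′) ≤ j ℕ.+ N
  zeros-step zero    zero⇒1≤j = ℕₚ.+-mono-≤ (zero⇒1≤j refl) zeros≤N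
  zeros-step (suc _) _        = ℕₚ.≤-trans zeros≤N (ℕₚ.m≤n+m N j)

ΛCoords-zero : ∀ {n} (ks : Vec ℕ n) rs rs′ qs → InBox ks rs → InBox ks rs′ →
  ΛCoords 0ℤ ks (zipWith _-_ (map +_ rs) (map +_ rs′)) qs → rs ≡ rs′ × sumℤ qs ≡ 0ℤ
ΛCoords-zero [] [] [] [] _ _ _ = refl , refl
ΛCoords-zero (k ∷ ks) (r ∷ rs) (r′ ∷ rs′) (q ∷ qs) (r<m , box) (r′<m , box′) (coord , coords)
  with offset-zero (k ∸ 1) r<m r′<m q coord | ΛCoords-zero ks rs rs′ qs box box′ coords
... | q≡0 , r≡r′ | rs≡rs′ , sum≡0 = cong₂ _∷_ r≡r′ rs≡rs′ , cong₂ _+_ q≡0 sum≡0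

ΛCoords-swap : ∀ {n} T (ks : Vec ℕ n) cs cs′ qs → ΛCoords T ks (zipWith _-_ cs cs′) qs →
  ΛCoords (- T) ks (zipWith _-_ cs′ cs) (map -_ qs)
ΛCoords-swap T []       []       []         []       tt               = tt
ΛCoords-swap T (k ∷ ks) (c ∷ cs) (c′ ∷ cs′) (q ∷ qs) (coord , coords) =
  trans (flip c c′) (trans (cong -_ coord) (negate T (+ (k ∸ 1)) q)) , ΛCoords-swap T ks cs cs′ qs coords
  where
  flip : ∀ a b → b - a ≡ - (a - b)
  flip = solve-∀
  negate : ∀ T m q → - (- T + m * q) ≡ - (- T) + m * (- q)
  negate = solve-∀

sumℤ-neg : ∀ {n} (qs : Vec ℤ n) → sumℤ (map -_ qs) ≡ - sumℤ qs
sumℤ-neg []       = refl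
sumℤ-neg (q ∷ qs) = trans (cong (_+_ (- q)) (sumℤ-neg qs)) (sym (ℤₚ.neg-distrib-+ q (sumℤ qs)))

∈Λ-swap : ∀ {n} (ks : Vec ℕ n) x y → (x -ᵖ y) ∈Λ ks → (y -ᵖ x) ∈Λ ks
∈Λ-swap ks (e , cs) (e′ , cs′) (T , qs , coords , x-coord) =
  - T , map -_ qs , ΛCoords-swap T ks cs cs′ qs coords ,
  trans (flip e e′) (trans (cong -_ x-coord)
    (trans (negate T (sumℤ qs)) (cong (λ w → - (- T) - w) (sym (sumℤ-neg qs)))))
  where
  flip : ∀ a b → b - a ≡ - (a - b)
  flip = solve-∀
  negate : ∀ T S → - (- T - S) ≡ - (- T) - (- S)
  negate = solve-∀

module _ {n} (ks : Vec ℕ n) where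

  canonical-pos-absurd : ∀ e rs e′ rs′ t qs → Canonical ks (e , rs) → Canonical ks (e′ , rs′) →
    ΛCoords (+ suc t) ks (zipWith _-_ (map +_ rs) (map +_ rs′)) qs → + e - + e′ ≡ - + suc t - sumℤ qs → ⊥
  canonical-pos-absurd e rs e′ rs′ t qs (box , _) (box′ , e′≤zeros) coords x-coord
    with ΛCoords-pos ks rs rs′ qs t box box′ coords
  ... | N , sum≡N , zeros≤N = ℕₚ.<-irrefl refl (begin-strict
    e′                       ≤⟨ ℕₚ.≤-trans e′≤zeros zeros≤N ⟩
    N                        <⟨ ℕₚ.m≤n+m (suc N) t ⟩
    t ℕ.+ suc N              ≡⟨ ℕₚ.+-suc t N ⟩
    suc t ℕ.+ N              ≤⟨ ℕₚ.m≤n+m _ e ⟩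
    e ℕ.+ (suc t ℕ.+ N)      ≡⟨ pos-sub-injective e e′ 0 (suc t ℕ.+ N) x-coord′ ⟩
    e′                       ∎)
    where
    open ℕₚ.≤-Reasoning
    combine : ∀ a b → - a - b ≡ 0ℤ - (a + b)
    combine = solve-∀
    x-coord′ : + e - + e′ ≡ 0ℤ - + (suc t ℕ.+ N)
    x-coord′ = trans x-coord (trans (cong (λ w → - + suc t - w) sum≡N)
                 (trans (combine (+ suc t) (+ N)) (cong (_-_ 0ℤ) (sym (ℤₚ.pos-+ (suc t) N)))))

  canonical-unique : ∀ p p′ → Canonical ks p → Canonical ks p′ → (toℤ p -ᵖ toℤ p′) ∈Λ ks → p ≡ p′
  canonical-unique (e , rs) (e′ , rs′) c c′ (+ zero , qs , coords , x-coord)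
    with ΛCoords-zero ks rs rs′ qs (proj₁ c) (proj₁ c′) coords
  ... | refl , sum≡0 = cong (_, rs) (begin
    e          ≡⟨ sym (ℕₚ.+-identityʳ e) ⟩
    e ℕ.+ 0    ≡⟨ pos-sub-injective e e′ 0 0 (trans x-coord (cong (λ w → - 0ℤ - w) sum≡0)) ⟩
    e′         ∎)
    where open ≡-Reasoning
  canonical-unique (e , rs) (e′ , rs′) c c′ (+ suc t , qs , coords , x-coord) =
    ⊥-elim (canonical-pos-absurd e rs e′ rs′ t qs c c′ coords x-coord)
  canonical-unique p@(e , rs) p′@(e′ , rs′) c c′ diff@(-[1+ t ] , _) =
    let (_ , qs′ , coords′ , x-coord′) = ∈Λ-swap ks (toℤ p) (toℤ p′) diff
    in ⊥-elim (canonical-pos-absurd e′ rs′ e rs t qs′ c′ c coords′ x-coord′)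

sumℤ-replicate-0 : ∀ n → sumℤ (replicate n 0ℤ) ≡ 0ℤ
sumℤ-replicate-0 zero    = refl
sumℤ-replicate-0 (suc n) = trans (ℤₚ.+-identityˡ _) (sumℤ-replicate-0 n)

sumℤ-zipWith-+ : ∀ {n} (qs qs′ : Vec ℤ n) → sumℤ (zipWith _+_ qs qs′) ≡ sumℤ qs + sumℤ qs′
sumℤ-zipWith-+ []       []         = refl
sumℤ-zipWith-+ (q ∷ qs) (q′ ∷ qs′) =
  trans (cong (_+_ (q + q′)) (sumℤ-zipWith-+ qs qs′)) (interchange q q′ (sumℤ qs) (sumℤ qs′))
  where
  interchange : ∀ a b c d → (a + b) + (c + d) ≡ (a + c) + (b + d)
  interchange = solve-∀

ΛCoords-refl : ∀ {n} (ks : Vec ℕ n) cs → ΛCoords 0ℤ ks (zipWith _-_ cs cs) (replicate n 0ℤ)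
ΛCoords-refl []       []       = tt
ΛCoords-refl (k ∷ ks) (c ∷ cs) = cancel c (+ (k ∸ 1)) , ΛCoords-refl ks cs
  where
  cancel : ∀ c m → c - c ≡ - 0ℤ + m * 0ℤ
  cancel = solve-∀

∈Λ-refl : ∀ {n} (ks : Vec ℕ n) x → (x -ᵖ x) ∈Λ ks
∈Λ-refl {n} ks (e , cs) =
  0ℤ , replicate n 0ℤ , ΛCoords-refl ks cs , trans (cancel e) (cong (λ w → - 0ℤ - w) (sym (sumℤ-replicate-0 n)))
  where
  cancel : ∀ e → e - e ≡ - 0ℤ - 0ℤ
  cancel = solve-∀

ΛCoords-trans : ∀ {n} T T′ (ks : Vec ℕ n) cs cs′ cs″ qs qs′ →
  ΛCoords T ks (zipWith _-_ cs cs′) qs → ΛCoords T′ ks (zipWith _-_ cs′ cs″) qs′ →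
  ΛCoords (T + T′) ks (zipWith _-_ cs cs″) (zipWith _+_ qs qs′)
ΛCoords-trans T T′ []       []       []         []         []       []         _ _ = tt
ΛCoords-trans T T′ (k ∷ ks) (c ∷ cs) (c′ ∷ cs′) (c″ ∷ cs″) (q ∷ qs) (q′ ∷ qs′)
              (coord , coords) (coord′ , coords′) =
  trans (telescope c c′ c″) (trans (cong₂ _+_ coord coord′) (add T T′ (+ (k ∸ 1)) q q′)) ,
  ΛCoords-trans T T′ ks cs cs′ cs″ qs qs′ coords coords′
  where
  telescope : ∀ a b c → a - c ≡ (a - b) + (b - c)
  telescope = solve-∀
  add : ∀ T T′ m q q′ → (- T + m * q) + (- T′ + m * q′) ≡ - (T + T′) + m * (q + q′)
  add = solve-∀

∈Λ-trans : ∀ {n} (ks : Vec ℕ n) x y w → (x -ᵖ y) ∈Λ ks → (y -ᵖ w) ∈Λ ks → (x -ᵖ w) ∈Λ ks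
∈Λ-trans ks (e , cs) (e′ , cs′) (e″ , cs″) (T , qs , coords , x-coord) (T′ , qs′ , coords′ , x-coord′) =
  T + T′ , zipWith _+_ qs qs′ , ΛCoords-trans T T′ ks cs cs′ cs″ qs qs′ coords coords′ ,
  trans (telescope e e′ e″)
        (trans (cong₂ _+_ x-coord x-coord′)
               (trans (add T T′ (sumℤ qs) (sumℤ qs′)) (cong (λ w → - (T + T′) - w) (sym (sumℤ-zipWith-+ qs qs′)))))
  where
  telescope : ∀ a b c → a - c ≡ (a - b) + (b - c)
  telescope = solve-∀
  add : ∀ T T′ S S′ → (- T - S) + (- T′ - S′) ≡ - (T + T′) - (S + S′)
  add = solve-∀

-- k − 1 for k ≥ 3, written so that instance search sees it is nonzero
modulus : ℕ → ℕ
modulus k = suc (suc (k ∸ 3))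

reduce : ∀ {n} → Vec ℕ n → Vec ℤ n → Vec ℕ n
reduce []       []       = []
reduce (k ∷ ks) (c ∷ cs) = c ℤ.%ℕ modulus k ∷ reduce ks cs

quotients : ∀ {n} → Vec ℕ n → Vec ℤ n → Vec ℤ n
quotients []       []       = []
quotients (k ∷ ks) (c ∷ cs) = c ℤ./ℕ modulus k ∷ quotients ks cs

reduce-InBox : ∀ {n} (ks : Vec ℕ n) cs → All (3 ≤_) ks → InBox ks (reduce ks cs)
reduce-InBox []       []       _            = tt
reduce-InBox (k ∷ ks) (c ∷ cs) (3≤k ∷ ks≥3) =
  subst (c ℤ.%ℕ modulus k <_) (sym (k∸1≡ 3≤k)) (ℤ.n%ℕd<d c (modulus k)) , reduce-InBox ks cs ks≥3

reduce-ΛCoords : ∀ {n} (ks : Vec ℕ n) cs → All (3 ≤_) ks →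
  ΛCoords 0ℤ ks (zipWith _-_ (map +_ (reduce ks cs)) cs) (map -_ (quotients ks cs))
reduce-ΛCoords []       []       _            = tt
reduce-ΛCoords (k ∷ ks) (c ∷ cs) (3≤k ∷ ks≥3) =
  trans (cong (_-_ (+ r)) (ℤ.a≡a%ℕn+[a/ℕn]*n c (modulus k)))
        (trans (divide (+ r) (c ℤ./ℕ modulus k) (+ modulus k))
               (cong (λ m → - 0ℤ + + m * - (c ℤ./ℕ modulus k)) (sym (k∸1≡ 3≤k)))) ,
  reduce-ΛCoords ks cs ks≥3
  where
  r = c ℤ.%ℕ modulus k
  divide : ∀ r q m → r - (r + q * m) ≡ - 0ℤ + m * - q
  divide = solve-∀

reduce-∈Λ : ∀ {n} (ks : Vec ℕ n) e cs → All (3 ≤_) ks →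
  ((e + sumℤ (quotients ks cs) , map +_ (reduce ks cs)) -ᵖ (e , cs)) ∈Λ ks
reduce-∈Λ ks e cs ks≥3 =
  0ℤ , map -_ (quotients ks cs) , reduce-ΛCoords ks cs ks≥3 ,
  trans (shift e (sumℤ (quotients ks cs))) (cong (λ w → - 0ℤ - w) (sym (sumℤ-neg (quotients ks cs))))
  where
  shift : ∀ e S → (e + S) - e ≡ - 0ℤ - (- S)
  shift = solve-∀

-- Adding the Λ-point with T = 1 and qᵢ = [rᵢ = 0] decrements every rᵢ cyclically.
decrementBox : ∀ {n} (ks : Vec ℕ n) → All (3 ≤_) ks → ∀ rs → InBox ks rs →
  ∃ λ rs′ → InBox ks rs′ × ∃ λ qs →
    ΛCoords (+ 1) ks (zipWith _-_ (map +_ rs′) (map +_ rs)) qs × sumℤ qs ≡ + #zeros rs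
decrementBox []       _ [] _ = [] , tt , [] , tt , refl
decrementBox (suc (suc (suc j)) ∷ ks) (s≤s (s≤s (s≤s _)) ∷ ks≥3) (zero ∷ rs) (_ , box)
  with decrementBox ks ks≥3 rs box
... | rs′ , box′ , qs , coords , sum≡ =
  suc j ∷ rs′ , (ℕₚ.n<1+n (suc j) , box′) , + 1 ∷ qs , (wrap (+ suc j) , coords) , cong (_+_ (+ 1)) sum≡
  where
  wrap : ∀ r → r - 0ℤ ≡ - + 1 + (+ 1 + r) * + 1
  wrap = solve-∀
decrementBox (suc (suc (suc j)) ∷ ks) (s≤s (s≤s (s≤s _)) ∷ ks≥3) (suc r ∷ rs) (r<m , box)
  with decrementBox ks ks≥3 rs box
... | rs′ , box′ , qs , coords , sum≡ =
  r ∷ rs′ , (ℕₚ.<-trans (ℕₚ.n<1+n r) r<m , box′) , 0ℤ ∷ qs , (down (+ r) (+ suc (suc j)) , coords) ,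
  trans (ℤₚ.+-identityˡ _) sum≡
  where
  down : ∀ r m → r - (+ 1 + r) ≡ - + 1 + m * 0ℤ
  down = solve-∀

-- The Λ-point with T = −1 and qᵢ = −[rᵢ′ = 0] increments every rᵢ cyclically.
incrementBox : ∀ {n} (ks : Vec ℕ n) → ∀ rs → InBox ks rs →
  ∃ λ rs′ → InBox ks rs′ × ∃ λ qs →
    ΛCoords -[1+ 0 ] ks (zipWith _-_ (map +_ rs′) (map +_ rs)) qs × sumℤ qs ≡ - + #zeros rs′
incrementBox []       [] _ = [] , tt , [] , tt , refl
incrementBox (k ∷ ks) (r ∷ rs) (r<m , box) with incrementBox ks rs box | suc r ℕ.<? k ∸ 1
... | rs′ , box′ , qs , coords , sum≡ | yes 1+r<m =
  suc r ∷ rs′ , (1+r<m , box′) , 0ℤ ∷ qs , (up (+ r) (+ (k ∸ 1)) , coords) , trans (ℤₚ.+-identityˡ _) sum≡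
  where
  up : ∀ r m → (+ 1 + r) - r ≡ - (- + 1) + m * 0ℤ
  up = solve-∀
... | rs′ , box′ , qs , coords , sum≡ | no 1+r≮m =
  0 ∷ rs′ , (ℕₚ.≤-<-trans z≤n r<m , box′) , -[1+ 0 ] ∷ qs ,
  (trans (wrap (+ r)) (cong (λ m → - (- + 1) + + m * - + 1) (sym m≡1+r)) , coords) ,
  trans (cong (_+_ -[1+ 0 ]) sum≡) (negate (+ #zeros rs′))
  where
  m≡1+r : k ∸ 1 ≡ suc r
  m≡1+r = sym (ℕₚ.≤-antisym r<m (ℕₚ.≮⇒≥ 1+r≮m))
  wrap : ∀ r → 0ℤ - r ≡ - (- + 1) + (+ 1 + r) * - + 1
  wrap = solve-∀
  negate : ∀ z → - + 1 + - z ≡ - (+ 1 + z)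
  negate = solve-∀

m⊖n≡-[1+n∸1+m] : ∀ {m n} → m < n → m ℤ.⊖ n ≡ -[1+ n ∸ suc m ]
m⊖n≡-[1+n∸1+m] {zero}  {suc n} _         = refl
m⊖n≡-[1+n∸1+m] {suc m} {suc n} (s≤s m<n) = trans (ℤₚ.[1+m]⊖[1+n]≡m⊖n m n) (m⊖n≡-[1+n∸1+m] m<n)

∸-suc-< : ∀ {j z} → z < j → j ∸ suc z < j
∸-suc-< z<j = ℕₚ.∸-monoʳ-< (s≤s z≤n) z<j

module _ {n} (ks : Vec ℕ n) (ks≥3 : All (3 ≤_) ks) where

  HasCanonical : ℤ × Vec ℤ n → Set
  HasCanonical x = Σ (ℕPoint n) λ p → Canonical ks p × (toℤ p -ᵖ x) ∈Λ ks

  decrement-∈Λ : ∀ rs → InBox ks rs → ∃ λ rs′ → InBox ks rs′ ×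
    ∀ e → ((e - + suc (#zeros rs) , map +_ rs′) -ᵖ (e , map +_ rs)) ∈Λ ks
  decrement-∈Λ rs box with decrementBox ks ks≥3 rs box
  ... | rs′ , box′ , qs , coords , sum≡ =
    rs′ , box′ , λ e → + 1 , qs , coords , trans (shift e (+ #zeros rs)) (cong (λ w → - + 1 - w) (sym sum≡))
    where
    shift : ∀ e z → (e - (+ 1 + z)) - e ≡ - + 1 - z
    shift = solve-∀

  increment-∈Λ : ∀ rs → InBox ks rs → ∃ λ rs′ → InBox ks rs′ ×
    ∀ e → ((e + + suc (#zeros rs′) , map +_ rs′) -ᵖ (e , map +_ rs)) ∈Λ ks
  increment-∈Λ rs box with incrementBox ks rs box
  ... | rs′ , box′ , qs , coords , sum≡ =
    rs′ , box′ , λ e → -[1+ 0 ] , qs , coords ,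
                       trans (shift e (+ #zeros rs′)) (cong (λ w → - (- + 1) - w) (sym sum≡))
    where
    shift : ∀ e z → (e + (+ 1 + z)) - e ≡ - (- + 1) - (- z)
    shift = solve-∀

  -- `bound` is fuel for the recursion: every step strictly decreases |e|.
  lower : ∀ bound j rs → j < bound → InBox ks rs → HasCanonical (+ j , map +_ rs)
  lower (suc b) j rs j<1+b box with j ℕ.≤? #zeros rs
  ... | yes j≤z = (j , rs) , (box , j≤z) , ∈Λ-refl ks (+ j , map +_ rs)
  ... | no  j≰z with decrement-∈Λ rs box
  ...   | rs′ , box′ , step
          with lower b (j ∸ suc (#zeros rs)) rs′ (ℕₚ.<-≤-trans (∸-suc-< (ℕₚ.≰⇒> j≰z)) (ℕₚ.≤-pred j<1+b)) box′
  ...     | p , canon , p∼ =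
            p , canon , ∈Λ-trans ks (toℤ p) (+ (j ∸ suc (#zeros rs)) , map +_ rs′) (+ j , map +_ rs) p∼
                          (subst (λ E → ((E , map +_ rs′) -ᵖ (+ j , map +_ rs)) ∈Λ ks) shifted (step (+ j)))
    where
    shifted : + j - + suc (#zeros rs) ≡ + (j ∸ suc (#zeros rs))
    shifted = trans (ℤₚ.[+m]-[+n]≡m⊖n j (suc (#zeros rs))) (ℤₚ.⊖-≥ (ℕₚ.≰⇒> j≰z))

  raise : ∀ bound j rs → j < bound → InBox ks rs → HasCanonical (-[1+ j ] , map +_ rs)
  raise (suc b) j rs j<1+b box with increment-∈Λ rs box
  ... | rs′ , box′ , step with j ℕ.≤? #zeros rs′
  ...   | yes j≤z′ =
          (#zeros rs′ ∸ j , rs′) , (box′ , ℕₚ.m∸n≤m _ j) ,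
          subst (λ E → ((E , map +_ rs′) -ᵖ (-[1+ j ] , map +_ rs)) ∈Λ ks)
                (trans (ℤₚ.[1+m]⊖[1+n]≡m⊖n (#zeros rs′) j) (ℤₚ.⊖-≥ j≤z′)) (step -[1+ j ])
  ...   | no  j≰z′
          with raise b (j ∸ suc (#zeros rs′)) rs′ (ℕₚ.<-≤-trans (∸-suc-< (ℕₚ.≰⇒> j≰z′)) (ℕₚ.≤-pred j<1+b)) box′
  ...     | p , canon , p∼ =
            p , canon , ∈Λ-trans ks (toℤ p) (-[1+ j ∸ suc (#zeros rs′) ] , map +_ rs′) (-[1+ j ] , map +_ rs) p∼
                          (subst (λ E → ((E , map +_ rs′) -ᵖ (-[1+ j ] , map +_ rs)) ∈Λ ks)
                                 (trans (ℤₚ.[1+m]⊖[1+n]≡m⊖n (#zeros rs′) j) (m⊖n≡-[1+n∸1+m] (ℕₚ.≰⇒> j≰z′)))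
                                 (step -[1+ j ]))

  canonical-exists : ∀ x → HasCanonical x
  canonical-exists (e , cs) =
    let (p , canon , p∼) = reduced (e + sumℤ (quotients ks cs))
    in p , canon , ∈Λ-trans ks (toℤ p) (e + sumℤ (quotients ks cs) , map +_ (reduce ks cs)) (e , cs)
                     p∼ (reduce-∈Λ ks e cs ks≥3)
    where
    box = reduce-InBox ks cs ks≥3
    reduced : ∀ E → HasCanonical (E , map +_ (reduce ks cs))
    reduced (+ j)    = lower (suc j) j _ ℕₚ.≤-refl box
    reduced -[1+ j ] = raise (suc j) j _ ℕₚ.≤-refl box

-- Counting canonical points

-- A canonical (e , r ∷ rs) either has e ≤ #zeros rs, or has r = 0 and e = 1 + #zeros rs.
#canonical : ∀ {n} → Vec ℕ n → ℕ
#canonical []       = 1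
#canonical (k ∷ ks) = (k ∸ 1) ℕ.* #canonical ks ℕ.+ prodPred ks

divPred-* : ∀ {k} a → 3 ≤ k → divPred ((k ∸ 1) ℕ.* a) k ≡ a
divPred-* {suc (suc (suc j))} a (s≤s (s≤s (s≤s _))) =
  trans (cong (ℕ._/ suc (suc j)) (ℕₚ.*-comm (suc (suc j)) a)) (ℕ.m*n/n≡m a (suc (suc j)))

sumQuot-* : ∀ {n} m a (ks : Vec ℕ n) → All (λ k → suc (k ∸ 2) ∣ a) ks → sumQuot (m ℕ.* a) ks ≡ m ℕ.* sumQuot a ks
sumQuot-* m a []       []         = sym (ℕₚ.*-zeroʳ m)
sumQuot-* m a (k ∷ ks) (k∣a ∷ ∣a) =
  trans (cong₂ ℕ._+_ (ℕ.*-/-assoc m k∣a) (sumQuot-* m a ks ∣a))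
        (sym (ℕₚ.*-distribˡ-+ m (divPred a k) (sumQuot a ks)))

∣prodPred : ∀ {n} (ks : Vec ℕ n) → All (3 ≤_) ks → All (λ k → suc (k ∸ 2) ∣ prodPred ks) ks
∣prodPred []       _            = []
∣prodPred (k ∷ ks) (3≤k ∷ ks≥3) = ∣m⇒∣m*n (prodPred ks) (k-1∣k-1 3≤k) ∷ extend (∣prodPred ks ks≥3)
  where
  k-1∣k-1 : ∀ {k} → 3 ≤ k → suc (k ∸ 2) ∣ k ∸ 1
  k-1∣k-1 (s≤s (s≤s (s≤s _))) = ∣-refl
  extend : ∀ {m} {js : Vec ℕ m} → All (λ j → suc (j ∸ 2) ∣ prodPred ks) js →
           All (λ j → suc (j ∸ 2) ∣ (k ∸ 1) ℕ.* prodPred ks) js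
  extend []         = []
  extend (j∣ ∷ js∣) = ∣n⇒∣m*n (k ∸ 1) j∣ ∷ extend js∣

#canonical≡ : ∀ {n} (ks : Vec ℕ n) → All (3 ≤_) ks → #canonical ks ≡ prodPred ks ℕ.+ sumQuot (prodPred ks) ks
#canonical≡ []       _            = refl
#canonical≡ (k ∷ ks) (3≤k ∷ ks≥3) = begin
  m ℕ.* #canonical ks ℕ.+ a                     ≡⟨ cong (λ w → m ℕ.* w ℕ.+ a) (#canonical≡ ks ks≥3) ⟩
  m ℕ.* (a ℕ.+ sumQuot a ks) ℕ.+ a              ≡⟨ rearrange m a (sumQuot a ks) ⟩
  m ℕ.* a ℕ.+ (a ℕ.+ m ℕ.* sumQuot a ks)
    ≡⟨ cong (λ w → m ℕ.* a ℕ.+ (w ℕ.+ m ℕ.* sumQuot a ks)) (sym (divPred-* a 3≤k)) ⟩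
  m ℕ.* a ℕ.+ (divPred (m ℕ.* a) k ℕ.+ m ℕ.* sumQuot a ks)
    ≡⟨ cong (λ w → m ℕ.* a ℕ.+ (divPred (m ℕ.* a) k ℕ.+ w)) (sym (sumQuot-* m a ks (∣prodPred ks ks≥3))) ⟩
  m ℕ.* a ℕ.+ (divPred (m ℕ.* a) k ℕ.+ sumQuot (m ℕ.* a) ks) ∎
  where
  open ≡-Reasoning
  m = k ∸ 1
  a = prodPred ks
  rearrange : ∀ m a s → m ℕ.* (a ℕ.+ s) ℕ.+ a ≡ m ℕ.* a ℕ.+ (a ℕ.+ m ℕ.* s)
  rearrange m a s = begin
    m ℕ.* (a ℕ.+ s) ℕ.+ a          ≡⟨ cong (ℕ._+ a) (ℕₚ.*-distribˡ-+ m a s) ⟩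
    m ℕ.* a ℕ.+ m ℕ.* s ℕ.+ a      ≡⟨ ℕₚ.+-assoc (m ℕ.* a) _ a ⟩
    m ℕ.* a ℕ.+ (m ℕ.* s ℕ.+ a)    ≡⟨ cong (m ℕ.* a ℕ.+_) (ℕₚ.+-comm (m ℕ.* s) a) ⟩
    m ℕ.* a ℕ.+ (a ℕ.+ m ℕ.* s)    ∎

remQuot-injective : ∀ {m} n (i j : Fin (m ℕ.* n)) → Fin.remQuot {m} n i ≡ Fin.remQuot {m} n j → i ≡ j
remQuot-injective {m} n i j eq = begin
  i                                ≡⟨ sym (Finₚ.combine-remQuot {m} n i) ⟩
  uncurry Fin.combine (Fin.remQuot {m} n i) ≡⟨ cong (uncurry Fin.combine) eq ⟩
  uncurry Fin.combine (Fin.remQuot {m} n j) ≡⟨ Finₚ.combine-remQuot {m} n j ⟩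
  j                                ∎
  where open ≡-Reasoning

boxPoint : ∀ {n} (ks : Vec ℕ n) → Fin (prodPred ks) → Vec ℕ n
boxPoint []       i = []
boxPoint (k ∷ ks) i = let (r , j) = Fin.remQuot {k ∸ 1} (prodPred ks) i in toℕ r ∷ boxPoint ks j

boxPoint-InBox : ∀ {n} (ks : Vec ℕ n) i → InBox ks (boxPoint ks i)
boxPoint-InBox []       i = tt
boxPoint-InBox (k ∷ ks) i = Finₚ.toℕ<n _ , boxPoint-InBox ks _

boxPoint-injective : ∀ {n} (ks : Vec ℕ n) i j → boxPoint ks i ≡ boxPoint ks j → i ≡ j
boxPoint-injective []       Fin.zero Fin.zero _  = refl
boxPoint-injective (k ∷ ks) i        j        eq =
  remQuot-injective {k ∸ 1} (prodPred ks) i j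
    (cong₂ _,_ (Finₚ.toℕ-injective (∷-injectiveˡ eq)) (boxPoint-injective ks _ _ (∷-injectiveʳ eq)))

boxPoint-surjective : ∀ {n} (ks : Vec ℕ n) rs → InBox ks rs → ∃ λ i → boxPoint ks i ≡ rs
boxPoint-surjective []       []       _           = Fin.zero , refl
boxPoint-surjective (k ∷ ks) (r ∷ rs) (r<m , box) with boxPoint-surjective ks rs box
... | j , refl = Fin.combine (Fin.fromℕ< r<m) j ,
  trans (cong (λ (q : Fin (k ∸ 1) × Fin (prodPred ks)) → toℕ (proj₁ q) ∷ boxPoint ks (proj₂ q))
              (Finₚ.remQuot-combine {k ∸ 1} (Fin.fromℕ< r<m) j))
        (cong (_∷ boxPoint ks j) (Finₚ.toℕ-fromℕ< r<m))

withDigit : ∀ {m N n} → (Fin N → ℕPoint n) → Fin m × Fin N → ℕPoint (suc n)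
withDigit point (r , j) = proj₁ (point j) , toℕ r ∷ proj₂ (point j)

extendPoint : ∀ {n} k (ks : Vec ℕ n) → (Fin (#canonical ks) → ℕPoint n) →
  Fin ((k ∸ 1) ℕ.* #canonical ks) ⊎ Fin (prodPred ks) → ℕPoint (suc n)
extendPoint k ks point (inj₁ i) = withDigit point (Fin.remQuot {k ∸ 1} (#canonical ks) i)
extendPoint k ks point (inj₂ i) = suc (#zeros (boxPoint ks i)) , 0 ∷ boxPoint ks i

canonicalPoint : ∀ {n} (ks : Vec ℕ n) → Fin (#canonical ks) → ℕPoint n
canonicalPoint []       _ = 0 , []
canonicalPoint (k ∷ ks) i =
  extendPoint k ks (canonicalPoint ks) (Fin.splitAt ((k ∸ 1) ℕ.* #canonical ks) i)

#zeros-∷ : ∀ {n} r (rs : Vec ℕ n) → #zeros rs ≤ #zeros (r ∷ rs)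
#zeros-∷ zero    rs = ℕₚ.n≤1+n _
#zeros-∷ (suc _) rs = ℕₚ.≤-refl

canonicalPoint-Canonical : ∀ {n} (ks : Vec ℕ n) → All (3 ≤_) ks → ∀ i → Canonical ks (canonicalPoint ks i)
canonicalPoint-Canonical []       _            i = tt , z≤n
canonicalPoint-Canonical (k ∷ ks) (3≤k ∷ ks≥3) i with Fin.splitAt ((k ∸ 1) ℕ.* #canonical ks) i
... | inj₁ i′ =
  let (r , j) = Fin.remQuot {k ∸ 1} (#canonical ks) i′
      (box , e≤zeros) = canonicalPoint-Canonical ks ks≥3 j
  in (Finₚ.toℕ<n r , box) , ℕₚ.≤-trans e≤zeros (#zeros-∷ (toℕ r) _)
... | inj₂ i′ = (0<k∸1 3≤k , boxPoint-InBox ks i′) , ℕₚ.≤-refl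
  where
  0<k∸1 : ∀ {k} → 3 ≤ k → 0 < k ∸ 1
  0<k∸1 (s≤s (s≤s (s≤s _))) = s≤s z≤n

extendPoint-disjoint : ∀ {n} k (ks : Vec ℕ n) → All (3 ≤_) ks → ∀ i i′ →
  extendPoint k ks (canonicalPoint ks) (inj₁ i) ≢ extendPoint k ks (canonicalPoint ks) (inj₂ i′)
extendPoint-disjoint k ks ks≥3 i i′ eq = ℕₚ.<-irrefl refl (begin-strict
  proj₁ (canonicalPoint ks j)              ≤⟨ proj₂ (canonicalPoint-Canonical ks ks≥3 j) ⟩
  #zeros (proj₂ (canonicalPoint ks j))     ≡⟨ cong #zeros (∷-injectiveʳ (cong proj₂ eq)) ⟩
  #zeros (boxPoint ks i′)                  <⟨ ℕₚ.n<1+n _ ⟩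
  suc (#zeros (boxPoint ks i′))            ≡⟨ sym (cong proj₁ eq) ⟩
  proj₁ (canonicalPoint ks j)              ∎)
  where
  open ℕₚ.≤-Reasoning
  j = proj₂ (Fin.remQuot {k ∸ 1} (#canonical ks) i)

canonicalPoint-injective : ∀ {n} (ks : Vec ℕ n) → All (3 ≤_) ks → ∀ i i′ →
  canonicalPoint ks i ≡ canonicalPoint ks i′ → i ≡ i′
canonicalPoint-injective []       _            Fin.zero Fin.zero _  = refl
canonicalPoint-injective (k ∷ ks) (3≤k ∷ ks≥3) i        i′       eq
  with Fin.splitAt ((k ∸ 1) ℕ.* #canonical ks) i in split≡ | Fin.splitAt ((k ∸ 1) ℕ.* #canonical ks) i′ in split≡′
... | inj₁ j | inj₁ j′ =
  trans (sym (Finₚ.splitAt⁻¹-↑ˡ split≡)) (trans (cong (Fin._↑ˡ prodPred ks) j≡j′) (Finₚ.splitAt⁻¹-↑ˡ split≡′))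
  where
  j≡j′ : j ≡ j′
  j≡j′ = remQuot-injective {k ∸ 1} (#canonical ks) j j′
    (cong₂ _,_ (Finₚ.toℕ-injective (∷-injectiveˡ (cong proj₂ eq)))
               (canonicalPoint-injective ks ks≥3 _ _ (cong₂ _,_ (cong proj₁ eq) (∷-injectiveʳ (cong proj₂ eq)))))
... | inj₁ j | inj₂ j′ = ⊥-elim (extendPoint-disjoint k ks ks≥3 j j′ eq)
... | inj₂ j | inj₁ j′ = ⊥-elim (extendPoint-disjoint k ks ks≥3 j′ j (sym eq))
... | inj₂ j | inj₂ j′ =
  trans (sym (Finₚ.splitAt⁻¹-↑ʳ split≡))
        (trans (cong ((k ∸ 1) ℕ.* #canonical ks Fin.↑ʳ_) (boxPoint-injective ks j j′ (∷-injectiveʳ (cong proj₂ eq))))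
               (Finₚ.splitAt⁻¹-↑ʳ split≡′))

canonicalPoint-surjective : ∀ {n} (ks : Vec ℕ n) → All (3 ≤_) ks → ∀ p → Canonical ks p →
  ∃ λ i → canonicalPoint ks i ≡ p
canonicalPoint-surjective []       _ (zero  , []) _        = Fin.zero , refl
canonicalPoint-surjective []       _ (suc e , []) (_ , ())
canonicalPoint-surjective (k ∷ ks) (3≤k ∷ ks≥3) (e , r ∷ rs) ((r<m , box) , e≤zeros)
  with e ℕ.≤? #zeros rs
... | yes e≤zeros′ with canonicalPoint-surjective ks ks≥3 (e , rs) (box , e≤zeros′)
...   | j , point≡ = combined Fin.↑ˡ prodPred ks , (begin
  extendPoint k ks (canonicalPoint ks) (Fin.splitAt _ (combined Fin.↑ˡ prodPred ks))
    ≡⟨ cong (extendPoint k ks (canonicalPoint ks)) (Finₚ.splitAt-↑ˡ _ combined (prodPred ks)) ⟩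
  withDigit (canonicalPoint ks) (Fin.remQuot {k ∸ 1} (#canonical ks) combined)
    ≡⟨ cong (withDigit (canonicalPoint ks)) (Finₚ.remQuot-combine {k ∸ 1} (Fin.fromℕ< r<m) j) ⟩
  proj₁ (canonicalPoint ks j) , toℕ (Fin.fromℕ< r<m) ∷ proj₂ (canonicalPoint ks j)
    ≡⟨ cong₂ _,_ (cong proj₁ point≡) (cong₂ _∷_ (Finₚ.toℕ-fromℕ< r<m) (cong proj₂ point≡)) ⟩
  e , r ∷ rs ∎)
  where
  open ≡-Reasoning
  combined = Fin.combine (Fin.fromℕ< r<m) j
canonicalPoint-surjective (k ∷ ks) (3≤k ∷ ks≥3) (e , zero ∷ rs) ((_ , box) , e≤zeros) | no e≰zeros′
  with boxPoint-surjective ks rs box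
... | j , refl = (k ∸ 1) ℕ.* #canonical ks Fin.↑ʳ j ,
  trans (cong (extendPoint k ks (canonicalPoint ks)) (Finₚ.splitAt-↑ʳ _ (prodPred ks) j))
        (cong (_, 0 ∷ boxPoint ks j) (ℕₚ.≤-antisym (ℕₚ.≰⇒> e≰zeros′) e≤zeros))
canonicalPoint-surjective (k ∷ ks) (3≤k ∷ ks≥3) (e , suc r ∷ rs) (_ , e≤zeros) | no e≰zeros′ =
  ⊥-elim (e≰zeros′ e≤zeros)

module _ {n} (ks : Vec ℕ n) (ks≥3 : All (3 ≤_) ks) where

  private
    G = hinge ks

  Ψ-laplacian∈Λ : ∀ z → Ψ ks (ext (laplacian G z)) ∈Λ ks
  Ψ-laplacian∈Λ z =
    subst (_∈Λ ks)
      (sym (Ψ-cong ks (ext-unique (laplacian G z) (laplacianℕ (edges G) (ext z))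
                                  (laplacian≡laplacianℕ G z) (laplacianℕ-hinge-outside (ext z) ks ks≥3))))
      (Ψ-laplacianℕ∈Λ ks ks≥3 (ext z))

  LinEq⇒∈Λ : ∀ d d′ → LinEq G d d′ → (Ψ ks (ext (proj₁ d)) -ᵖ Ψ ks (ext (proj₁ d′))) ∈Λ ks
  LinEq⇒∈Λ (d , _) (d′ , _) (z , d-d′≡Lz) =
    subst (_∈Λ ks) (trans (Ψ-cong ks (ext-cong (λ v → sym (d-d′≡Lz v)))) (Ψ-ext-sub ks d d′)) (Ψ-laplacian∈Λ z)

  ∈Λ⇒LinEq : ∀ d d′ → (Ψ ks (ext (proj₁ d)) -ᵖ Ψ ks (ext (proj₁ d′))) ∈Λ ks → LinEq G d d′
  ∈Λ⇒LinEq (d , deg≡0) (d′ , deg′≡0) diff∈Λ =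
    Ψ∈Λ⇒principal ks ks≥3 (λ v → d v - d′ v)
      (trans (Σℤ-sub d d′) (cong₂ _-_ deg≡0 deg′≡0))
      (subst (_∈Λ ks) (sym (Ψ-ext-sub ks d d′)) diff∈Λ)

  representative : Fin (#canonical ks) → Div⁰ G
  representative i = divisorOf ks p , Σℤ-divisorOf ks ks≥3 p
    where p = toℤ (canonicalPoint ks i)

  Ψ-representative : ∀ i → Ψ ks (ext (proj₁ (representative i))) ≡ toℤ (canonicalPoint ks i)
  Ψ-representative i = Ψ-divisorOf ks ks≥3 (toℤ (canonicalPoint ks i))

  representative-surjective : ∀ d → ∃ λ i → LinEq G (representative i) d
  representative-surjective d =
    let (p , canon , p-Ψd∈Λ) = canonical-exists ks ks≥3 (Ψ ks (ext (proj₁ d)))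
        (i , point≡p) = canonicalPoint-surjective ks ks≥3 p canon
    in i , ∈Λ⇒LinEq (representative i) d
             (subst (λ x → (x -ᵖ Ψ ks (ext (proj₁ d))) ∈Λ ks)
                    (sym (trans (Ψ-representative i) (cong toℤ point≡p))) p-Ψd∈Λ)

  representative-injective : ∀ i j → LinEq G (representative i) (representative j) → i ≡ j
  representative-injective i j i∼j =
    canonicalPoint-injective ks ks≥3 i j
      (canonical-unique ks (canonicalPoint ks i) (canonicalPoint ks j)
        (canonicalPoint-Canonical ks ks≥3 i) (canonicalPoint-Canonical ks ks≥3 j)
        (subst (_∈Λ ks) (cong₂ _-ᵖ_ (Ψ-representative i) (Ψ-representative j))
               (LinEq⇒∈Λ (representative i) (representative j) i∼j)))

  criticalGroupOrder : CriticalGroupOrder G (#canonical ks)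
  criticalGroupOrder = representative , representative-surjective , representative-injective

-- The argument works for every n.
theorem4p1 : (n : ℕ) → 2 ≤ n → (ks : Vec ℕ n) → All (3 ≤_) ks →
    CriticalGroupOrder (hinge ks) (prodPred ks ℕ.+ sumQuot (prodPred ks) ks)
theorem4p1 n _ ks ks≥3 =
  subst (CriticalGroupOrder (hinge ks)) (#canonical≡ ks ks≥3) (criticalGroupOrder ks ks≥3)
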